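{- There exist nested $(v,4,1)$-BIBDs for every $v\in\{376, 388, 544, 556, 568, 580, 880, 892, 1120, 1132, 1144, 1156\}$.
   Context: A $(v,k,\lambda)$-BIBD is a pair $(X,\mathcal{A})$ with $X$ a set of $v$ points and $\mathcal{A}$ a collection of $k$-subsets (blocks) such that every pair of distinct points lies in exactly $\lambda$ blocks; a partial one has "at most $\lambda$". A nested $(v,k,\lambda)$-BIBD is a $(v,k,\lambda)$-BIBD $(X,\mathcal{A})$ together with a map $\phi:\mathcal{A}\to X$ such that $(X,\{A\cup\{\phi(A)\}:A\in\mathcal{A}\})$ is a partial $(v,k+1,\lambda+1)$-BIBD (augmented blocks of size $k+1$). -}

module Defs where

open import Data.Nat using (ℕ; _≤_; suc)
open import Data.Fin using (Fin)
open import Data.Fin.Properties using (_≟_)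
open import Data.Vec using (Vec; _∷_)
open import Data.Vec.Relation.Unary.Unique.Propositional using (Unique)
open import Data.Vec.Membership.Propositional using (_∈_; _∉_)
open import Data.List using (List; length; filter; map)
open import Data.List.Relation.Unary.All using (All)
open import Data.Product using (_×_; _,_; proj₁; Σ)
open import Relation.Nullary using (¬_)
open import Relation.Nullary.Decidable using (_×-dec_)
open import Relation.Binary.PropositionalEquality using (_≡_)

record Block (v k : ℕ) : Set where
  constructor block
  field
    pts      : Vec (Fin v) k
    distinct : Unique pts
open Block public

pairCount : ∀ {v k} → List (Block v k) → Fin v → Fin v → ℕ
pairCount {v} 𝒜 x y =
  length (filter (λ B → (x ∈? pts B) ×-dec (y ∈? pts B)) 𝒜)
  where open import Data.Vec.Membership.DecPropositional (_≟_ {v}) using (_∈?_)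

IsBIBD : (v k λ' : ℕ) → List (Block v k) → Set
IsBIBD v k λ' 𝒜 = ∀ (x y : Fin v) → ¬ x ≡ y → pairCount 𝒜 x y ≡ λ'

IsPartialBIBD : (v k λ' : ℕ) → List (Block v k) → Set
IsPartialBIBD v k λ' 𝒜 = ∀ (x y : Fin v) → ¬ x ≡ y → pairCount 𝒜 x y ≤ λ'

-- A nested block: a block A together with the nesting point φ(A), such that
-- the augmented block A ∪ {φ(A)} is a (k+1)-subset (i.e. φ(A) ∉ A).
record NestedBlock (v k : ℕ) : Set where
  constructor nblock
  field
    blk        : Block v k
    φ          : Fin v
    augDistinct : Unique (φ ∷ pts blk)
open NestedBlock public

augment : ∀ {v k} → NestedBlock v k → Block v (suc k)
augment B = block (φ B ∷ pts (blk B)) (augDistinct B)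

-- A nested (v,k,λ)-BIBD on Fin v: a list of blocks each with its nesting
-- point (this is the map φ : 𝒜 → X), such that the underlying blocks form a
-- (v,k,λ)-BIBD and the augmented blocks form a partial (v,k+1,λ+1)-BIBD.
IsNestedBIBD : (v k λ' : ℕ) → List (NestedBlock v k) → Set
IsNestedBIBD v k λ' 𝒩 =
  IsBIBD v k λ' (map blk 𝒩) × IsPartialBIBD v (suc k) (suc λ') (map augment 𝒩)

NestedBIBDExists : (v k λ' : ℕ) → Set
NestedBIBDExists v k λ' = Σ (List (NestedBlock v k)) (IsNestedBIBD v k λ')

{-# OPTIONS --safe #-}
-- Work in ℤ_v with v = 4q. Each design is cyclic: all v translates of some nested base blocks
-- together with the q translates of the subgroup H = {0, q, 2q, 3q}, nested by a further point p.
-- Summing over translates, the number of blocks of a full orbit containing x and y is the number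
-- of ordered pairs of the base block with difference y − x, and the short orbit of H, whose full
-- development is four copies of it, realises each element of H once as a difference. Hence the
-- blocks form a (v,4,1)-BIBD once every nonzero residue is a difference exactly once in the base
-- blocks or in H. In the augmented short orbit the pairs through p + t are bounded by their count
-- over all v translates, so the augmented blocks form a partial (v,5,2)-BIBD once every nonzero
-- residue occurs at most twice among the differences of the augmented base blocks, of H, and
-- between p and p ∪ H. For the twelve orders these finitely many conditions are decided by
-- sorting the lists of differences.
module Submission where

open import Defs
open import Data.Empty using (⊥)
open import Data.Fin using (Fin; toℕ; #_)
open import Data.Fin.Properties using (_≟_; toℕ-fromℕ<; toℕ-injective; toℕ<n)
open import Data.List using (List; []; _∷_; _∷ʳ_; _++_; map; concatMap; concat; replicate; filter; length; downFrom; upTo)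
open import Data.List.Membership.Propositional using (_∈_)
open import Data.List.Properties using (map-++; map-cong; reverse-upTo; ≡-dec)
open import Data.List.Relation.Binary.Permutation.Propositional using (_↭_; ↭-sym; ↭-trans)
open import Data.List.Relation.Binary.Permutation.Propositional.Properties using (↭-reverse; ∷↭∷ʳ) renaming (map⁺ to ↭-map⁺)
open import Data.List.Relation.Binary.Sublist.Propositional as Sublist using (_⊆_; []; _∷_)
open import Data.List.Relation.Unary.All as All using (All; []; _∷_)
open import Data.Nat as ℕ using (ℕ; zero; suc; _+_; _*_; _∸_; _<_; _≤_; z≤n; NonZero; nonZero)
open import Data.Nat.DivMod using (_%_; _mod_; %-distribˡ-+; m%n%n≡m%n; m%n<n; m%n≤n; m<n⇒m%n≡m; [m+n]%n≡m%n; n%n≡0)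
open import Data.Nat.ListAction using (sum)
open import Data.Nat.ListAction.Properties using (sum-++; sum-↭)
open import Data.Nat.Properties hiding (_≟_)
open import Data.Product using (_,_)
open import Data.Vec using (Vec; []; _∷_; toList; head; tail) renaming (map to mapᵛ)
open import Data.Vec.Properties using (toList-map)
open import Data.Vec.Relation.Unary.All using (lookupWith)
open import Data.Vec.Relation.Unary.AllPairs as AllPairs using (_∷_; allPairs?)
open import Data.Vec.Relation.Unary.Any using (Any; here; there)
open import Data.Vec.Relation.Unary.Unique.Propositional using (Unique)
open import Data.Vec.Relation.Unary.Unique.Propositional.Properties as Unique using ()
open import Function using (_∘_)
open import Level using (0ℓ)
open import Relation.Binary.PropositionalEquality
open import Relation.Nullary using (Dec; yes; no; ¬_; contradiction)
open import Relation.Nullary.Decidable using (_×-dec_; ¬?; True; toWitness)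
open import Relation.Unary using (Pred; Decidable)

open import Algebra.Properties.CommutativeSemigroup +-commutativeSemigroup using (interchange)
open import Data.List.Relation.Binary.Sublist.DecPropositional ℕ._≟_ using (_⊆?_)
open import Data.List.Sort.MergeSort ≤-decTotalOrder using (sort)
open import Data.List.Sort.MergeSort.Properties ≤-decTotalOrder using (sort-↭)

𝟙 : {P : Set} → Dec P → ℕ
𝟙 (yes _) = 1
𝟙 (no _)  = 0

𝟙-yes : {P : Set} (p : Dec P) → P → 𝟙 p ≡ 1
𝟙-yes (yes _) _ = refl
𝟙-yes (no ¬p) p = contradiction p ¬p

𝟙-no : {P : Set} (p : Dec P) → ¬ P → 𝟙 p ≡ 0
𝟙-no (yes p) ¬p = contradiction p ¬p
𝟙-no (no _)  _  = refl

𝟙-×-dec : {P Q : Set} (p : Dec P) (q : Dec Q) → 𝟙 (p ×-dec q) ≡ 𝟙 p * 𝟙 q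
𝟙-×-dec (yes _) (yes _) = refl
𝟙-×-dec (yes _) (no _)  = refl
𝟙-×-dec (no _)  _       = refl

𝟙-⇔ : {P Q : Set} (p : Dec P) (q : Dec Q) → (P → Q) → (Q → P) → 𝟙 p ≡ 𝟙 q
𝟙-⇔ (yes _) (yes _) _   _   = refl
𝟙-⇔ (no _)  (no _)  _   _   = refl
𝟙-⇔ (yes p) (no ¬q) p⇒q _   = contradiction (p⇒q p) ¬q
𝟙-⇔ (no ¬p) (yes q) _   q⇒p = contradiction (q⇒p q) ¬p

∑ : {A : Set} → List A → (A → ℕ) → ℕ
∑ xs f = sum (map f xs)

infixr 6.5 ∑
syntax ∑ xs (λ x → e) = ∑[ x ← xs ] e

module _ {A : Set} where

  ∑-++ : ∀ xs ys (f : A → ℕ) → ∑ (xs ++ ys) f ≡ ∑ xs f + ∑ ys f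
  ∑-++ xs ys f = trans (cong sum (map-++ f xs ys)) (sum-++ (map f xs) (map f ys))

  ∑-cong : ∀ xs {f g : A → ℕ} → (∀ x → f x ≡ g x) → ∑ xs f ≡ ∑ xs g
  ∑-cong xs f≗g = cong sum (map-cong f≗g xs)

  ∑-+ : ∀ xs (f g : A → ℕ) → ∑[ x ← xs ] (f x + g x) ≡ ∑ xs f + ∑ xs g
  ∑-+ []       f g = refl
  ∑-+ (x ∷ xs) f g = trans (cong (f x + g x +_) (∑-+ xs f g)) (interchange (f x) (g x) _ _)

  *-distribˡ-∑ : ∀ c xs (f : A → ℕ) → c * ∑ xs f ≡ ∑[ x ← xs ] (c * f x)
  *-distribˡ-∑ c []       f = *-zeroʳ c
  *-distribˡ-∑ c (x ∷ xs) f = trans (*-distribˡ-+ c (f x) _) (cong (c * f x +_) (*-distribˡ-∑ c xs f))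

  ∑-↭ : ∀ {xs ys} (f : A → ℕ) → xs ↭ ys → ∑ xs f ≡ ∑ ys f
  ∑-↭ f xs↭ys = sum-↭ (↭-map⁺ f xs↭ys)

  ∑∑-∷ : ∀ p xs (h : A → A → ℕ) →
    ∑[ u ← p ∷ xs ] ∑[ w ← p ∷ xs ] h u w
      ≡ (∑[ w ← p ∷ xs ] h p w + ∑[ u ← xs ] h u p) + ∑[ u ← xs ] ∑[ w ← xs ] h u w
  ∑∑-∷ p xs h = trans (cong (∑ (p ∷ xs) (h p) +_) (∑-+ xs (λ u → h u p) _))
    (sym (+-assoc (∑ (p ∷ xs) (h p)) (∑[ u ← xs ] h u p) _))

  ∑-⊆ : ∀ {xs ys} (f : A → ℕ) → xs ⊆ ys → ∑ xs f ≤ ∑ ys f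
  ∑-⊆ f []                   = z≤n
  ∑-⊆ f (y Sublist.∷ʳ xs⊆ys) = ≤-trans (∑-⊆ f xs⊆ys) (m≤n+m _ (f y))
  ∑-⊆ f (refl ∷ xs⊆ys)       = +-monoʳ-≤ _ (∑-⊆ f xs⊆ys)

  ∑-filter : {P : Pred A 0ℓ} (P? : Decidable P) → ∀ xs {f : A → ℕ} →
    (∀ x → ¬ P x → f x ≡ 0) → ∑ (filter P? xs) f ≡ ∑ xs f
  ∑-filter P? []       f≡0 = refl
  ∑-filter P? (x ∷ xs) {f} f≡0 with P? x
  ... | yes _  = cong (f x +_) (∑-filter P? xs f≡0)
  ... | no ¬px = trans (∑-filter P? xs f≡0) (cong (_+ ∑ xs f) (sym (f≡0 x ¬px)))

  length-filter≡∑𝟙 : {P : Pred A 0ℓ} (P? : Decidable P) (xs : List A) → length (filter P? xs) ≡ ∑[ x ← xs ] 𝟙 (P? x)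
  length-filter≡∑𝟙 P? []       = refl
  length-filter≡∑𝟙 P? (x ∷ xs) with P? x
  ... | yes _ = cong suc (length-filter≡∑𝟙 P? xs)
  ... | no _  = length-filter≡∑𝟙 P? xs

module _ {A B : Set} where

  ∑-map : ∀ (g : A → B) xs (f : B → ℕ) → ∑ (map g xs) f ≡ ∑[ x ← xs ] f (g x)
  ∑-map g []       f = refl
  ∑-map g (x ∷ xs) f = cong (f (g x) +_) (∑-map g xs f)

  ∑-concatMap : ∀ (g : A → List B) xs (f : B → ℕ) → ∑ (concatMap g xs) f ≡ ∑[ x ← xs ] ∑ (g x) f
  ∑-concatMap g []       f = refl
  ∑-concatMap g (x ∷ xs) f = trans (∑-++ (g x) _ f) (cong (∑ (g x) f +_) (∑-concatMap g xs f))

  ∑-comm : ∀ xs ys (f : A → B → ℕ) → ∑[ x ← xs ] ∑[ y ← ys ] f x y ≡ ∑[ y ← ys ] ∑[ x ← xs ] f x y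
  ∑-comm []       ys f = sym (∑-zero ys)
    where
    ∑-zero : ∀ (ys : List B) → ∑[ y ← ys ] 0 ≡ 0
    ∑-zero []       = refl
    ∑-zero (_ ∷ ys) = ∑-zero ys
  ∑-comm (x ∷ xs) ys f = trans (cong (∑ ys (f x) +_) (∑-comm xs ys f)) (sym (∑-+ ys (f x) _))

  ∑-*-∑ : ∀ xs ys (f : A → ℕ) (g : B → ℕ) → ∑ xs f * ∑ ys g ≡ ∑[ x ← xs ] ∑[ y ← ys ] f x * g y
  ∑-*-∑ xs ys f g = begin
    ∑ xs f * ∑ ys g                     ≡⟨ *-comm (∑ xs f) _ ⟩
    ∑ ys g * ∑ xs f                     ≡⟨ *-distribˡ-∑ (∑ ys g) xs f ⟩
    ∑[ x ← xs ] (∑ ys g * f x)          ≡⟨ ∑-cong xs (λ x → trans (*-comm _ (f x)) (*-distribˡ-∑ (f x) ys g)) ⟩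
    ∑[ x ← xs ] ∑[ y ← ys ] f x * g y   ∎
    where open ≡-Reasoning

∑-downFrom-+ : ∀ m n (f : ℕ → ℕ) → ∑ (downFrom (m + n)) f ≡ ∑[ t ← downFrom m ] f (n + t) + ∑ (downFrom n) f
∑-downFrom-+ zero    n f = refl
∑-downFrom-+ (suc m) n f = begin
  f (m + n) + ∑ (downFrom (m + n)) f
    ≡⟨ cong₂ _+_ (cong f (+-comm m n)) (∑-downFrom-+ m n f) ⟩
  f (n + m) + (∑[ t ← downFrom m ] f (n + t) + ∑ (downFrom n) f)
    ≡⟨ +-assoc (f (n + m)) _ _ ⟨
  f (n + m) + ∑[ t ← downFrom m ] f (n + t) + ∑ (downFrom n) f ∎
  where open ≡-Reasoning

∑-downFrom-cong : ∀ n {f g : ℕ → ℕ} → (∀ {t} → t < n → f t ≡ g t) → ∑ (downFrom n) f ≡ ∑ (downFrom n) g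
∑-downFrom-cong zero    f≗g = refl
∑-downFrom-cong (suc n) f≗g = cong₂ _+_ (f≗g ≤-refl) (∑-downFrom-cong n (λ t<n → f≗g (m<n⇒m<1+n t<n)))

∑-downFrom-mono : ∀ {m n} (f : ℕ → ℕ) → m ≤ n → ∑ (downFrom m) f ≤ ∑ (downFrom n) f
∑-downFrom-mono {m} {n} f m≤n = begin
  ∑ (downFrom m) f                                                ≤⟨ m≤n+m _ _ ⟩
  ∑[ t ← downFrom (n ∸ m) ] f (m + t) + ∑ (downFrom m) f          ≡⟨ ∑-downFrom-+ (n ∸ m) m f ⟨
  ∑ (downFrom (n ∸ m + m)) f                                      ≡⟨ cong (λ k → ∑ (downFrom k) f) (m∸n+n≡m m≤n) ⟩
  ∑ (downFrom n) f                                                ∎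
  where open ≤-Reasoning

∑-downFrom-periodic : ∀ q (f : ℕ → ℕ) → (∀ t → f (q + t) ≡ f t) → ∀ m → ∑ (downFrom (m * q)) f ≡ m * ∑ (downFrom q) f
∑-downFrom-periodic q f f-periodic zero    = refl
∑-downFrom-periodic q f f-periodic (suc m) = begin
  ∑ (downFrom (q + m * q)) f                                  ≡⟨ ∑-downFrom-+ q (m * q) f ⟩
  ∑[ t ← downFrom q ] f (m * q + t) + ∑ (downFrom (m * q)) f
    ≡⟨ cong₂ _+_ (∑-cong (downFrom q) (f-periodic* m)) (∑-downFrom-periodic q f f-periodic m) ⟩
  ∑ (downFrom q) f + m * ∑ (downFrom q) f                     ∎
  where
  open ≡-Reasoning
  f-periodic* : ∀ m t → f (m * q + t) ≡ f t
  f-periodic* zero    t = refl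
  f-periodic* (suc m) t = trans (cong f (+-assoc q (m * q) t)) (trans (f-periodic _) (f-periodic* m t))

∑-downFrom-𝟙≡ : ∀ {n τ} (f : ℕ → ℕ) → τ < n → ∑[ t ← downFrom n ] 𝟙 (t ℕ.≟ τ) * f t ≡ f τ
∑-downFrom-𝟙≡ {suc n} {τ} f τ<1+n with n ℕ.≟ τ
... | yes refl = trans (cong (1 * f n +_) (∑-downFrom-𝟙-absent n ≤-refl)) (trans (+-identityʳ _) (*-identityˡ (f n)))
  where
  ∑-downFrom-𝟙-absent : ∀ k → k ≤ τ → ∑[ t ← downFrom k ] 𝟙 (t ℕ.≟ τ) * f t ≡ 0
  ∑-downFrom-𝟙-absent zero    _     = refl
  ∑-downFrom-𝟙-absent (suc k) 1+k≤τ with k ℕ.≟ τ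
  ... | yes refl = contradiction 1+k≤τ (<-irrefl refl)
  ... | no _     = ∑-downFrom-𝟙-absent k (<⇒≤ 1+k≤τ)
... | no n≢τ   = ∑-downFrom-𝟙≡ f (≤∧≢⇒< (≤-pred τ<1+n) (n≢τ ∘ sym))

multiplicity : ℕ → List ℕ → ℕ
multiplicity d ds = ∑[ e ← ds ] 𝟙 (d ℕ.≟ e)

positive : List ℕ → List ℕ
positive = filter (0 <?_)

twice : List ℕ → List ℕ
twice = concatMap (λ d → d ∷ d ∷ [])

multiplicity-positive : ∀ {d} ds → 0 < d → multiplicity d (positive ds) ≡ multiplicity d ds
multiplicity-positive {d} ds 0<d = ∑-filter (0 <?_) ds (λ e 0≮e → 𝟙-no (d ℕ.≟ e) (λ d≡e → 0≮e (subst (0 <_) d≡e 0<d)))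

multiplicity-upTo : ∀ {d n} → d < n → multiplicity d (upTo n) ≡ 1
multiplicity-upTo {d} {n} d<n = begin
  multiplicity d (upTo n)                  ≡⟨ ∑-↭ _ downFrom↭upTo ⟨
  ∑[ t ← downFrom n ] 𝟙 (d ℕ.≟ t)
    ≡⟨ ∑-cong (downFrom n) (λ t → trans (𝟙-⇔ (d ℕ.≟ t) (t ℕ.≟ d) sym sym) (sym (*-identityʳ _))) ⟩
  ∑[ t ← downFrom n ] 𝟙 (t ℕ.≟ d) * 1      ≡⟨ ∑-downFrom-𝟙≡ (λ _ → 1) d<n ⟩
  1                                        ∎
  where
  open ≡-Reasoning
  downFrom↭upTo : downFrom n ↭ upTo n
  downFrom↭upTo = subst (_↭ upTo n) (reverse-upTo n) (↭-reverse (upTo n))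

multiplicity-twice : ∀ d ds → multiplicity d (twice ds) ≡ 2 * multiplicity d ds
multiplicity-twice d ds = trans (∑-concatMap _ ds _) (sym (*-distribˡ-∑ 2 ds _))

multiplicity-concat-replicate : ∀ d m ds → multiplicity d (concat (replicate m ds)) ≡ m * multiplicity d ds
multiplicity-concat-replicate d zero    ds = refl
multiplicity-concat-replicate d (suc m) ds =
  trans (∑-++ ds _ _) (cong (multiplicity d ds +_) (multiplicity-concat-replicate d m ds))

[m%n+o]%n≡[m+o]%n : ∀ m o n .{{_ : NonZero n}} → (m % n + o) % n ≡ (m + o) % n
[m%n+o]%n≡[m+o]%n m o n = begin
  (m % n + o) % n          ≡⟨ %-distribˡ-+ (m % n) o n ⟩
  (m % n % n + o % n) % n  ≡⟨ cong (λ a → (a + o % n) % n) (m%n%n≡m%n m n) ⟩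
  (m % n + o % n) % n      ≡⟨ %-distribˡ-+ m o n ⟨
  (m + o) % n              ∎
  where open ≡-Reasoning

[m+o%n]%n≡[m+o]%n : ∀ m o n .{{_ : NonZero n}} → (m + o % n) % n ≡ (m + o) % n
[m+o%n]%n≡[m+o]%n m o n = begin
  (m + o % n) % n  ≡⟨ cong (_% n) (+-comm m (o % n)) ⟩
  (o % n + m) % n  ≡⟨ [m%n+o]%n≡[m+o]%n o m n ⟩
  (o + m) % n      ≡⟨ cong (_% n) (+-comm o m) ⟩
  (m + o) % n      ∎
  where open ≡-Reasoning

m+n+[o∸m]≡n+o : ∀ {m o} n → m ≤ o → m + n + (o ∸ m) ≡ n + o
m+n+[o∸m]≡n+o {m} {o} n m≤o = begin
  m + n + (o ∸ m)    ≡⟨ cong (_+ (o ∸ m)) (+-comm m n) ⟩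
  n + m + (o ∸ m)    ≡⟨ +-assoc n m (o ∸ m) ⟩
  n + (m + (o ∸ m))  ≡⟨ cong (n +_) (m+[n∸m]≡n m≤o) ⟩
  n + o              ∎
  where open ≡-Reasoning

module Cyclic (v : ℕ) .{{_ : NonZero v}} where

  infixl 6 _+ᵗ_
  infix 7 _⊖_

  _+ᵗ_ : Fin v → ℕ → Fin v
  x +ᵗ t = (toℕ x + t) mod v

  _⊖_ : Fin v → Fin v → ℕ
  y ⊖ x = (toℕ y + (v ∸ toℕ x)) % v

  toℕ-+ᵗ : ∀ x t → toℕ (x +ᵗ t) ≡ (toℕ x + t) % v
  toℕ-+ᵗ x t = toℕ-fromℕ< _

  ⊖<v : ∀ y x → y ⊖ x < v
  ⊖<v y x = m%n<n _ v

  +ᵗ-identityʳ : ∀ x → x +ᵗ 0 ≡ x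
  +ᵗ-identityʳ x = toℕ-injective (begin
    toℕ (x +ᵗ 0)      ≡⟨ toℕ-+ᵗ x 0 ⟩
    (toℕ x + 0) % v   ≡⟨ cong (_% v) (+-identityʳ (toℕ x)) ⟩
    toℕ x % v         ≡⟨ m<n⇒m%n≡m (toℕ<n x) ⟩
    toℕ x             ∎)
    where open ≡-Reasoning

  +ᵗ-assoc : ∀ x s t → x +ᵗ s +ᵗ t ≡ x +ᵗ (s + t)
  +ᵗ-assoc x s t = toℕ-injective (begin
    toℕ (x +ᵗ s +ᵗ t)            ≡⟨ toℕ-+ᵗ (x +ᵗ s) t ⟩
    (toℕ (x +ᵗ s) + t) % v       ≡⟨ cong (λ a → (a + t) % v) (toℕ-+ᵗ x s) ⟩
    ((toℕ x + s) % v + t) % v    ≡⟨ [m%n+o]%n≡[m+o]%n (toℕ x + s) t v ⟩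
    (toℕ x + s + t) % v          ≡⟨ cong (_% v) (+-assoc (toℕ x) s t) ⟩
    (toℕ x + (s + t)) % v        ≡⟨ toℕ-+ᵗ x (s + t) ⟨
    toℕ (x +ᵗ (s + t))           ∎)
    where open ≡-Reasoning

  +ᵗ-% : ∀ x t → x +ᵗ t % v ≡ x +ᵗ t
  +ᵗ-% x t = toℕ-injective (begin
    toℕ (x +ᵗ t % v)       ≡⟨ toℕ-+ᵗ x (t % v) ⟩
    (toℕ x + t % v) % v    ≡⟨ [m+o%n]%n≡[m+o]%n (toℕ x) t v ⟩
    (toℕ x + t) % v        ≡⟨ toℕ-+ᵗ x t ⟨
    toℕ (x +ᵗ t)           ∎)
    where open ≡-Reasoning

  +ᵗ-⊖ : ∀ u x → u +ᵗ (x ⊖ u) ≡ x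
  +ᵗ-⊖ u x = toℕ-injective (begin
    toℕ (u +ᵗ (x ⊖ u))                    ≡⟨ cong toℕ (+ᵗ-% u _) ⟩
    toℕ (u +ᵗ (toℕ x + (v ∸ toℕ u)))      ≡⟨ toℕ-+ᵗ u _ ⟩
    (toℕ u + (toℕ x + (v ∸ toℕ u))) % v   ≡⟨ cong (_% v) (+-assoc (toℕ u) (toℕ x) _) ⟨
    (toℕ u + toℕ x + (v ∸ toℕ u)) % v     ≡⟨ cong (_% v) (m+n+[o∸m]≡n+o (toℕ x) (<⇒≤ (toℕ<n u))) ⟩
    (toℕ x + v) % v                       ≡⟨ [m+n]%n≡m%n (toℕ x) v ⟩
    toℕ x % v                             ≡⟨ m<n⇒m%n≡m (toℕ<n x) ⟩
    toℕ x                                 ∎)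
    where open ≡-Reasoning

  ⊖-+ᵗ : ∀ u t → (u +ᵗ t) ⊖ u ≡ t % v
  ⊖-+ᵗ u t = begin
    (toℕ (u +ᵗ t) + (v ∸ toℕ u)) % v       ≡⟨ cong (λ a → (a + (v ∸ toℕ u)) % v) (toℕ-+ᵗ u t) ⟩
    ((toℕ u + t) % v + (v ∸ toℕ u)) % v    ≡⟨ [m%n+o]%n≡[m+o]%n (toℕ u + t) _ v ⟩
    (toℕ u + t + (v ∸ toℕ u)) % v          ≡⟨ cong (_% v) (m+n+[o∸m]≡n+o t (<⇒≤ (toℕ<n u))) ⟩
    (t + v) % v                            ≡⟨ [m+n]%n≡m%n t v ⟩
    t % v                                  ∎
    where open ≡-Reasoning

  ≡+ᵗ⇒≡⊖ : ∀ {x u t} → t < v → x ≡ u +ᵗ t → t ≡ x ⊖ u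
  ≡+ᵗ⇒≡⊖ {u = u} {t} t<v refl = sym (trans (⊖-+ᵗ u t) (m<n⇒m%n≡m t<v))

  ≡⊖⇒≡+ᵗ : ∀ {x u t} → t ≡ x ⊖ u → x ≡ u +ᵗ t
  ≡⊖⇒≡+ᵗ {x} {u} refl = sym (+ᵗ-⊖ u x)

  +ᵗ-⊖-comm : ∀ u w x → w +ᵗ (x ⊖ u) ≡ x +ᵗ (w ⊖ u)
  +ᵗ-⊖-comm u w x = begin
    w +ᵗ (x ⊖ u)                  ≡⟨ cong (_+ᵗ (x ⊖ u)) (+ᵗ-⊖ u w) ⟨
    u +ᵗ (w ⊖ u) +ᵗ (x ⊖ u)       ≡⟨ +ᵗ-assoc u (w ⊖ u) (x ⊖ u) ⟩
    u +ᵗ (w ⊖ u + x ⊖ u)          ≡⟨ cong (u +ᵗ_) (+-comm (w ⊖ u) (x ⊖ u)) ⟩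
    u +ᵗ (x ⊖ u + w ⊖ u)          ≡⟨ +ᵗ-assoc u (x ⊖ u) (w ⊖ u) ⟨
    u +ᵗ (x ⊖ u) +ᵗ (w ⊖ u)       ≡⟨ cong (_+ᵗ (w ⊖ u)) (+ᵗ-⊖ u x) ⟩
    x +ᵗ (w ⊖ u)                  ∎
    where open ≡-Reasoning

  +ᵗ-inverse : ∀ x t → x +ᵗ t +ᵗ (v ∸ t % v) ≡ x
  +ᵗ-inverse x t = begin
    x +ᵗ t +ᵗ (v ∸ t % v)              ≡⟨ +ᵗ-assoc x t _ ⟩
    x +ᵗ (t + (v ∸ t % v))             ≡⟨ +ᵗ-% x _ ⟨
    x +ᵗ (t + (v ∸ t % v)) % v         ≡⟨ cong (x +ᵗ_) multiple-of-v ⟩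
    x +ᵗ 0                             ≡⟨ +ᵗ-identityʳ x ⟩
    x                                  ∎
    where
    open ≡-Reasoning
    multiple-of-v : (t + (v ∸ t % v)) % v ≡ 0
    multiple-of-v = begin
      (t + (v ∸ t % v)) % v        ≡⟨ [m%n+o]%n≡[m+o]%n t _ v ⟨
      (t % v + (v ∸ t % v)) % v    ≡⟨ cong (_% v) (m+[n∸m]≡n (m%n≤n t v)) ⟩
      v % v                        ≡⟨ n%n≡0 v ⟩
      0                            ∎

  +ᵗ-injective : ∀ t {x y} → x +ᵗ t ≡ y +ᵗ t → x ≡ y
  +ᵗ-injective t {x} {y} eq = begin
    x                         ≡⟨ +ᵗ-inverse x t ⟨
    x +ᵗ t +ᵗ (v ∸ t % v)     ≡⟨ cong (_+ᵗ (v ∸ t % v)) eq ⟩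
    y +ᵗ t +ᵗ (v ∸ t % v)     ≡⟨ +ᵗ-inverse y t ⟩
    y                         ∎
    where open ≡-Reasoning

  translate : ∀ {k} → ℕ → Block v k → Block v k
  translate t B = block (mapᵛ (_+ᵗ t) (pts B)) (Unique.map⁺ (+ᵗ-injective t) (distinct B))

  translateNested : ∀ {k} → ℕ → NestedBlock v k → NestedBlock v k
  translateNested t N = nblock (translate t (blk N)) (φ N +ᵗ t) (Unique.map⁺ (+ᵗ-injective t) (augDistinct N))

  orbit : ∀ {k} → List ℕ → NestedBlock v k → List (NestedBlock v k)
  orbit ts N = map (λ t → translateNested t N) ts

  open import Data.Vec.Membership.DecPropositional (_≟_ {v}) using (_∈?_)

  𝟙-∈?-unique : ∀ {n} x (us : Vec (Fin v) n) → Unique us → 𝟙 (x ∈? us) ≡ ∑[ u ← toList us ] 𝟙 (x ≟ u)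
  𝟙-∈?-unique x []       _            = refl
  𝟙-∈?-unique x (u ∷ us) (u∉us ∷ uus) = split (x ≟ u)
    where
    x∉us : x ≡ u → ¬ Any (x ≡_) us
    x∉us refl = lookupWith {R = λ _ → ⊥} (λ x≢y → x≢y) u∉us

    split : (x≟u : Dec (x ≡ u)) → 𝟙 (x ∈? (u ∷ us)) ≡ 𝟙 x≟u + ∑[ w ← toList us ] 𝟙 (x ≟ w)
    split (yes x≡u) = begin
      𝟙 (x ∈? (u ∷ us))                  ≡⟨ 𝟙-yes (x ∈? (u ∷ us)) (here x≡u) ⟩
      1                                  ≡⟨ cong suc (𝟙-no (x ∈? us) (x∉us x≡u)) ⟨
      1 + 𝟙 (x ∈? us)                    ≡⟨ cong suc (𝟙-∈?-unique x us uus) ⟩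
      1 + ∑[ w ← toList us ] 𝟙 (x ≟ w)   ∎
      where open ≡-Reasoning
    split (no x≢u) = trans (𝟙-⇔ (x ∈? (u ∷ us)) (x ∈? us) x∈us there) (𝟙-∈?-unique x us uus)
      where
      x∈us : Any (x ≡_) (u ∷ us) → Any (x ≡_) us
      x∈us (here x≡u)  = contradiction x≡u x≢u
      x∈us (there x∈us) = x∈us

  pairIndicator : ∀ {k} → Fin v → Fin v → Block v k → ℕ
  pairIndicator x y B = 𝟙 (x ∈? pts B) * 𝟙 (y ∈? pts B)

  pairCount≡∑pairIndicator : ∀ {k} (𝒜 : List (Block v k)) x y → pairCount 𝒜 x y ≡ ∑[ B ← 𝒜 ] pairIndicator x y B
  pairCount≡∑pairIndicator 𝒜 x y =
    trans (length-filter≡∑𝟙 _ 𝒜) (∑-cong 𝒜 (λ B → 𝟙-×-dec (x ∈? pts B) (y ∈? pts B)))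

  hit : Fin v → Fin v → ℕ → Fin v → Fin v → ℕ
  hit x y t u w = 𝟙 (x ≟ u +ᵗ t) * 𝟙 (y ≟ w +ᵗ t)

  -- Exactly one translate, t = x ⊖ u, carries u to x, and it carries w to y iff y ⊖ x = w ⊖ u.
  ∑-hit : ∀ x y u w → ∑[ t ← downFrom v ] hit x y t u w ≡ 𝟙 (y ⊖ x ℕ.≟ w ⊖ u)
  ∑-hit x y u w = begin
    ∑[ t ← downFrom v ] 𝟙 (x ≟ u +ᵗ t) * 𝟙 (y ≟ w +ᵗ t)
      ≡⟨ ∑-downFrom-cong v (λ t<v → cong (_* _) (𝟙-⇔ (x ≟ _) (_ ℕ.≟ _) (≡+ᵗ⇒≡⊖ t<v) ≡⊖⇒≡+ᵗ)) ⟩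
    ∑[ t ← downFrom v ] 𝟙 (t ℕ.≟ x ⊖ u) * 𝟙 (y ≟ w +ᵗ t)
      ≡⟨ ∑-downFrom-𝟙≡ (λ t → 𝟙 (y ≟ w +ᵗ t)) (⊖<v x u) ⟩
    𝟙 (y ≟ w +ᵗ (x ⊖ u))
      ≡⟨ cong (λ z → 𝟙 (y ≟ z)) (+ᵗ-⊖-comm u w x) ⟩
    𝟙 (y ≟ x +ᵗ (w ⊖ u))
      ≡⟨ 𝟙-⇔ (y ≟ _) (_ ℕ.≟ _) (≡+ᵗ⇒≡⊖ (⊖<v w u)) ≡⊖⇒≡+ᵗ ⟩
    𝟙 (w ⊖ u ℕ.≟ y ⊖ x)
      ≡⟨ 𝟙-⇔ (_ ℕ.≟ _) (_ ℕ.≟ _) sym sym ⟩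
    𝟙 (y ⊖ x ℕ.≟ w ⊖ u)
      ∎
    where open ≡-Reasoning

  ∑-∑∑-hit : ∀ x y us ws →
    ∑[ t ← downFrom v ] ∑[ u ← us ] ∑[ w ← ws ] hit x y t u w ≡ ∑[ u ← us ] ∑[ w ← ws ] 𝟙 (y ⊖ x ℕ.≟ w ⊖ u)
  ∑-∑∑-hit x y us ws = trans (∑-comm (downFrom v) us _) (∑-cong us (λ u →
    trans (∑-comm (downFrom v) ws _) (∑-cong ws (∑-hit x y u))))

  differences : ∀ {k} → Vec (Fin v) k → List ℕ
  differences A = concatMap (λ u → map (_⊖ u) (toList A)) (toList A)

  multiplicity-differences : ∀ {k} d (A : Vec (Fin v) k) →
    multiplicity d (differences A) ≡ ∑[ u ← toList A ] ∑[ w ← toList A ] 𝟙 (d ℕ.≟ w ⊖ u)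
  multiplicity-differences d A = trans (∑-concatMap _ (toList A) _) (∑-cong (toList A) (λ u → ∑-map (_⊖ u) (toList A) _))

  𝟙-∈?-translate : ∀ {k} x t (A : Vec (Fin v) k) → Unique A →
    𝟙 (x ∈? mapᵛ (_+ᵗ t) A) ≡ ∑[ u ← toList A ] 𝟙 (x ≟ u +ᵗ t)
  𝟙-∈?-translate x t A unique-A = begin
    𝟙 (x ∈? mapᵛ (_+ᵗ t) A)                        ≡⟨ 𝟙-∈?-unique x _ (Unique.map⁺ (+ᵗ-injective t) unique-A) ⟩
    ∑[ u ← toList (mapᵛ (_+ᵗ t) A) ] 𝟙 (x ≟ u)     ≡⟨ cong (λ us → ∑[ u ← us ] 𝟙 (x ≟ u)) (toList-map _ A) ⟩
    ∑[ u ← map (_+ᵗ t) (toList A) ] 𝟙 (x ≟ u)      ≡⟨ ∑-map _ (toList A) _ ⟩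
    ∑[ u ← toList A ] 𝟙 (x ≟ u +ᵗ t)               ∎
    where open ≡-Reasoning

  pairIndicator-translate : ∀ {k} x y t (B : Block v k) →
    pairIndicator x y (translate t B) ≡ ∑[ u ← toList (pts B) ] ∑[ w ← toList (pts B) ] hit x y t u w
  pairIndicator-translate x y t B = trans
    (cong₂ _*_ (𝟙-∈?-translate x t (pts B) (distinct B)) (𝟙-∈?-translate y t (pts B) (distinct B)))
    (∑-*-∑ (toList (pts B)) (toList (pts B)) _ _)

  ∑-pairIndicator-development : ∀ {k} x y (B : Block v k) →
    ∑[ t ← downFrom v ] pairIndicator x y (translate t B) ≡ multiplicity (y ⊖ x) (differences (pts B))
  ∑-pairIndicator-development x y B = begin
    ∑[ t ← downFrom v ] pairIndicator x y (translate t B)               ≡⟨ ∑-cong (downFrom v) (λ t → pairIndicator-translate x y t B) ⟩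
    ∑[ t ← downFrom v ] ∑[ u ← A ] ∑[ w ← A ] hit x y t u w             ≡⟨ ∑-∑∑-hit x y A A ⟩
    ∑[ u ← A ] ∑[ w ← A ] 𝟙 (y ⊖ x ℕ.≟ w ⊖ u)                           ≡⟨ multiplicity-differences (y ⊖ x) (pts B) ⟨
    multiplicity (y ⊖ x) (differences (pts B))                          ∎
    where
    open ≡-Reasoning
    A = toList (pts B)

  𝟙-∈?-shift-invariant : ∀ {k} q x t (A : Vec (Fin v) k) → Unique A → toList (mapᵛ (_+ᵗ q) A) ↭ toList A →
    𝟙 (x ∈? mapᵛ (_+ᵗ (q + t)) A) ≡ 𝟙 (x ∈? mapᵛ (_+ᵗ t) A)
  𝟙-∈?-shift-invariant q x t A unique-A A+q↭A = begin
    𝟙 (x ∈? mapᵛ (_+ᵗ (q + t)) A)                    ≡⟨ 𝟙-∈?-translate x (q + t) A unique-A ⟩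
    ∑[ u ← toList A ] 𝟙 (x ≟ u +ᵗ (q + t))           ≡⟨ ∑-cong (toList A) (λ u → cong (λ z → 𝟙 (x ≟ z)) (+ᵗ-assoc u q t)) ⟨
    ∑[ u ← toList A ] 𝟙 (x ≟ u +ᵗ q +ᵗ t)            ≡⟨ ∑-map (_+ᵗ q) (toList A) _ ⟨
    ∑[ u ← map (_+ᵗ q) (toList A) ] 𝟙 (x ≟ u +ᵗ t)   ≡⟨ cong (λ us → ∑[ u ← us ] 𝟙 (x ≟ u +ᵗ t)) (toList-map _ A) ⟨
    ∑[ u ← toList (mapᵛ (_+ᵗ q) A) ] 𝟙 (x ≟ u +ᵗ t)  ≡⟨ ∑-↭ _ A+q↭A ⟩
    ∑[ u ← toList A ] 𝟙 (x ≟ u +ᵗ t)                 ≡⟨ 𝟙-∈?-translate x t A unique-A ⟨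
    𝟙 (x ∈? mapᵛ (_+ᵗ t) A)                          ∎
    where open ≡-Reasoning

  m*∑-pairIndicator-shortOrbit : ∀ {k} x y m q (H : Block v k) → m * q ≡ v → toList (mapᵛ (_+ᵗ q) (pts H)) ↭ toList (pts H) →
    m * (∑[ t ← downFrom q ] pairIndicator x y (translate t H)) ≡ multiplicity (y ⊖ x) (differences (pts H))
  m*∑-pairIndicator-shortOrbit x y m q H m*q≡v H+q↭H = begin
    m * (∑[ t ← downFrom q ] pairIndicator x y (translate t H))    ≡⟨ ∑-downFrom-periodic q _ periodic m ⟨
    ∑[ t ← downFrom (m * q) ] pairIndicator x y (translate t H)  ≡⟨ cong (λ n → ∑[ t ← downFrom n ] pairIndicator x y (translate t H)) m*q≡v ⟩
    ∑[ t ← downFrom v ] pairIndicator x y (translate t H)        ≡⟨ ∑-pairIndicator-development x y H ⟩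
    multiplicity (y ⊖ x) (differences (pts H))                   ∎
    where
    open ≡-Reasoning
    periodic : ∀ t → pairIndicator x y (translate (q + t) H) ≡ pairIndicator x y (translate t H)
    periodic t = cong₂ _*_ (𝟙-∈?-shift-invariant q x t (pts H) (distinct H) H+q↭H)
                           (𝟙-∈?-shift-invariant q y t (pts H) (distinct H) H+q↭H)

  crossDifferences : ∀ {k} → Fin v → Vec (Fin v) k → List ℕ
  crossDifferences p A = map (_⊖ p) (p ∷ toList A) ++ map (p ⊖_) (toList A)

  crossHits : ∀ {k} → Fin v → Fin v → ℕ → NestedBlock v k → ℕ
  crossHits x y t N = ∑[ w ← φ N ∷ A ] hit x y t (φ N) w + ∑[ u ← A ] hit x y t u (φ N)
    where A = toList (pts (blk N))

  pairIndicator-augment : ∀ {k} x y t (N : NestedBlock v k) →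
    pairIndicator x y (translate t (augment N)) ≡ crossHits x y t N + pairIndicator x y (translate t (blk N))
  pairIndicator-augment x y t N = begin
    pairIndicator x y (translate t (augment N))
      ≡⟨ pairIndicator-translate x y t (augment N) ⟩
    ∑[ u ← φ N ∷ A ] ∑[ w ← φ N ∷ A ] hit x y t u w
      ≡⟨ ∑∑-∷ (φ N) A (hit x y t) ⟩
    crossHits x y t N + ∑[ u ← A ] ∑[ w ← A ] hit x y t u w
      ≡⟨ cong (crossHits x y t N +_) (pairIndicator-translate x y t (blk N)) ⟨
    crossHits x y t N + pairIndicator x y (translate t (blk N))
      ∎
    where
    open ≡-Reasoning
    A = toList (pts (blk N))

  ∑-crossHits : ∀ {k} x y (N : NestedBlock v k) →
    ∑[ t ← downFrom v ] crossHits x y t N ≡ multiplicity (y ⊖ x) (crossDifferences (φ N) (pts (blk N)))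
  ∑-crossHits x y N = begin
    ∑[ t ← downFrom v ] crossHits x y t N
      ≡⟨ ∑-+ (downFrom v) _ _ ⟩
    ∑[ t ← downFrom v ] ∑[ w ← p ∷ A ] hit x y t p w + ∑[ t ← downFrom v ] ∑[ u ← A ] hit x y t u p
      ≡⟨ cong₂ _+_ (trans (∑-comm (downFrom v) (p ∷ A) _) (∑-cong (p ∷ A) (∑-hit x y p)))
                   (trans (∑-comm (downFrom v) A _) (∑-cong A (λ u → ∑-hit x y u p))) ⟩
    ∑[ w ← p ∷ A ] 𝟙 (y ⊖ x ℕ.≟ w ⊖ p) + ∑[ u ← A ] 𝟙 (y ⊖ x ℕ.≟ p ⊖ u)
      ≡⟨ cong₂ _+_ (∑-map (_⊖ p) (p ∷ A) _) (∑-map (p ⊖_) A _) ⟨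
    multiplicity (y ⊖ x) (map (_⊖ p) (p ∷ A)) + multiplicity (y ⊖ x) (map (p ⊖_) A)
      ≡⟨ ∑-++ (map (_⊖ p) (p ∷ A)) (map (p ⊖_) A) _ ⟨
    multiplicity (y ⊖ x) (crossDifferences (φ N) (pts (blk N)))
      ∎
    where
    open ≡-Reasoning
    p = φ N
    A = toList (pts (blk N))

  -- The pairs through the nesting point are bounded by their count over the full development.
  ∑-pairIndicator-augmented-shortOrbit : ∀ {k} x y q (N : NestedBlock v k) → q ≤ v →
    ∑[ t ← downFrom q ] pairIndicator x y (translate t (augment N))
      ≤ ∑[ t ← downFrom q ] pairIndicator x y (translate t (blk N)) + multiplicity (y ⊖ x) (crossDifferences (φ N) (pts (blk N)))
  ∑-pairIndicator-augmented-shortOrbit x y q N q≤v = begin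
    ∑[ t ← downFrom q ] pairIndicator x y (translate t (augment N))
      ≡⟨ ∑-cong (downFrom q) (λ t → pairIndicator-augment x y t N) ⟩
    ∑[ t ← downFrom q ] (crossHits x y t N + pairIndicator x y (translate t (blk N)))
      ≡⟨ ∑-+ (downFrom q) _ _ ⟩
    ∑[ t ← downFrom q ] crossHits x y t N + shortOrbitPairs
      ≤⟨ +-monoˡ-≤ shortOrbitPairs (∑-downFrom-mono (λ t → crossHits x y t N) q≤v) ⟩
    ∑[ t ← downFrom v ] crossHits x y t N + shortOrbitPairs
      ≡⟨ cong (_+ shortOrbitPairs) (∑-crossHits x y N) ⟩
    multiplicity (y ⊖ x) (crossDifferences (φ N) (pts (blk N))) + shortOrbitPairs
      ≡⟨ +-comm (multiplicity (y ⊖ x) (crossDifferences (φ N) (pts (blk N)))) shortOrbitPairs ⟩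
    shortOrbitPairs + multiplicity (y ⊖ x) (crossDifferences (φ N) (pts (blk N)))
      ∎
    where
    open ≤-Reasoning
    shortOrbitPairs = ∑[ t ← downFrom q ] pairIndicator x y (translate t (blk N))

  allDifferences : ∀ {k} → List (Vec (Fin v) k) → List ℕ
  allDifferences = concatMap differences

  ⊖-positive : ∀ {x y} → x ≢ y → 0 < y ⊖ x
  ⊖-positive {x} {y} x≢y = n≢0⇒n>0 (λ y⊖x≡0 → x≢y (sym (trans (≡⊖⇒≡+ᵗ (sym y⊖x≡0)) (+ᵗ-identityʳ x))))

  -- S is invariant under translation by q, where m * q = v, so its full development consists of
  -- m copies of its q translates.
  module ShortOrbitDesign {k} (bases : List (NestedBlock v k)) (S : NestedBlock v k) (m q : ℕ) .{{_ : NonZero m}}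
    (m*q≡v : m * q ≡ v) (S+q↭S : toList (mapᵛ (_+ᵗ q) (pts (blk S))) ↭ toList (pts (blk S)))
    (shortDifferences : List ℕ)
    (S-differences : ∀ d → multiplicity d (differences (pts (blk S))) ≡ m * multiplicity d shortDifferences)
    where

    design : List (NestedBlock v k)
    design = concatMap (orbit (downFrom v)) bases ++ orbit (downFrom q) S

    plainDifferences : List ℕ
    plainDifferences = allDifferences (map (pts ∘ blk) bases) ++ shortDifferences

    augmentedDifferences : List ℕ
    augmentedDifferences = allDifferences (map (pts ∘ augment) bases) ++ shortDifferences ++ crossDifferences (φ S) (pts (blk S))

    pairCount-design : ∀ {k′} (f : NestedBlock v k → Block v k′) → (∀ t N → f (translateNested t N) ≡ translate t (f N)) →
      ∀ x y → pairCount (map f design) x y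
                ≡ multiplicity (y ⊖ x) (allDifferences (map (pts ∘ f) bases))
                  + ∑[ t ← downFrom q ] pairIndicator x y (translate t (f S))
    pairCount-design f f-translate x y = begin
      pairCount (map f design) x y
        ≡⟨ pairCount≡∑pairIndicator (map f design) x y ⟩
      ∑[ B ← map f design ] pairIndicator x y B
        ≡⟨ ∑-map f design _ ⟩
      ∑[ N ← design ] pairIndicator x y (f N)
        ≡⟨ ∑-++ (concatMap (orbit (downFrom v)) bases) (orbit (downFrom q) S) _ ⟩
      ∑[ N ← concatMap (orbit (downFrom v)) bases ] pairIndicator x y (f N) + ∑[ N ← orbit (downFrom q) S ] pairIndicator x y (f N)
        ≡⟨ cong₂ _+_ (∑-concatMap (orbit (downFrom v)) bases _) (∑-orbit (downFrom q) S) ⟩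
      ∑[ N ← bases ] ∑[ N′ ← orbit (downFrom v) N ] pairIndicator x y (f N′) + shortOrbitPairs
        ≡⟨ cong (_+ shortOrbitPairs) (∑-cong bases (λ N → trans (∑-orbit (downFrom v) N) (∑-pairIndicator-development x y (f N)))) ⟩
      ∑[ N ← bases ] multiplicity (y ⊖ x) (differences (pts (f N))) + shortOrbitPairs
        ≡⟨ cong (_+ shortOrbitPairs) (trans (∑-concatMap differences (map (pts ∘ f) bases) _) (∑-map (pts ∘ f) bases _)) ⟨
      multiplicity (y ⊖ x) (allDifferences (map (pts ∘ f) bases)) + shortOrbitPairs
        ∎
      where
      open ≡-Reasoning
      shortOrbitPairs = ∑[ t ← downFrom q ] pairIndicator x y (translate t (f S))
      ∑-orbit : ∀ ts N → ∑[ N′ ← orbit ts N ] pairIndicator x y (f N′) ≡ ∑[ t ← ts ] pairIndicator x y (translate t (f N))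
      ∑-orbit ts N = trans (∑-map _ ts _) (∑-cong ts (λ t → cong (pairIndicator x y) (f-translate t N)))

    ∑-pairIndicator-shortOrbit : ∀ x y →
      ∑[ t ← downFrom q ] pairIndicator x y (translate t (blk S)) ≡ multiplicity (y ⊖ x) shortDifferences
    ∑-pairIndicator-shortOrbit x y = *-cancelˡ-≡ _ _ m
      (trans (m*∑-pairIndicator-shortOrbit x y m q (blk S) m*q≡v S+q↭S) (S-differences (y ⊖ x)))

    design-isBIBD : (∀ d → 0 < d → d < v → multiplicity d plainDifferences ≡ 1) → IsBIBD v k 1 (map blk design)
    design-isBIBD exactlyOnce x y x≢y = begin
      pairCount (map blk design) x y
        ≡⟨ pairCount-design blk (λ _ _ → refl) x y ⟩
      multiplicity D baseDifferences + ∑[ t ← downFrom q ] pairIndicator x y (translate t (blk S))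
        ≡⟨ cong (multiplicity D baseDifferences +_) (∑-pairIndicator-shortOrbit x y) ⟩
      multiplicity D baseDifferences + multiplicity D shortDifferences
        ≡⟨ ∑-++ baseDifferences shortDifferences _ ⟨
      multiplicity D plainDifferences
        ≡⟨ exactlyOnce D (⊖-positive x≢y) (⊖<v y x) ⟩
      1 ∎
      where
      open ≡-Reasoning
      D = y ⊖ x
      baseDifferences = allDifferences (map (pts ∘ blk) bases)

    design-augmented-isPartialBIBD : (∀ d → 0 < d → d < v → multiplicity d augmentedDifferences ≤ 2) →
      IsPartialBIBD v (suc k) 2 (map augment design)
    design-augmented-isPartialBIBD atMostTwice x y x≢y = begin
      pairCount (map augment design) x y
        ≡⟨ pairCount-design augment (λ _ _ → refl) x y ⟩
      multiplicity D baseDifferences + ∑[ t ← downFrom q ] pairIndicator x y (translate t (augment S))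
        ≤⟨ +-monoʳ-≤ (multiplicity D baseDifferences) (∑-pairIndicator-augmented-shortOrbit x y q S q≤v) ⟩
      multiplicity D baseDifferences + (∑[ t ← downFrom q ] pairIndicator x y (translate t (blk S)) + multiplicity D cross)
        ≡⟨ cong (λ n → multiplicity D baseDifferences + (n + multiplicity D cross)) (∑-pairIndicator-shortOrbit x y) ⟩
      multiplicity D baseDifferences + (multiplicity D shortDifferences + multiplicity D cross)
        ≡⟨ cong (multiplicity D baseDifferences +_) (∑-++ shortDifferences cross _) ⟨
      multiplicity D baseDifferences + multiplicity D (shortDifferences ++ cross)
        ≡⟨ ∑-++ baseDifferences (shortDifferences ++ cross) _ ⟨
      multiplicity D augmentedDifferences
        ≤⟨ atMostTwice D (⊖-positive x≢y) (⊖<v y x) ⟩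
      2 ∎
      where
      open ≤-Reasoning
      D = y ⊖ x
      baseDifferences = allDifferences (map (pts ∘ augment) bases)
      cross = crossDifferences (φ S) (pts (blk S))
      q≤v : q ≤ v
      q≤v = subst (q ≤_) m*q≡v (m≤n*m q m)

    design-isNestedBIBD : (∀ d → 0 < d → d < v → multiplicity d plainDifferences ≡ 1) →
      (∀ d → 0 < d → d < v → multiplicity d augmentedDifferences ≤ 2) → IsNestedBIBD v k 1 design
    design-isNestedBIBD exactlyOnce atMostTwice = design-isBIBD exactlyOnce , design-augmented-isPartialBIBD atMostTwice

↭-bySorting : ∀ xs ys → sort xs ≡ sort ys → xs ↭ ys
↭-bySorting xs ys eq = ↭-trans (↭-sym (sort-↭ xs)) (subst (_↭ ys) (sym eq) (sort-↭ ys))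

exactlyOnce-bySorting : ∀ {n} ds → sort (positive ds) ≡ positive (upTo n) → ∀ d → 0 < d → d < n → multiplicity d ds ≡ 1
exactlyOnce-bySorting {n} ds eq d 0<d d<n = begin
  multiplicity d ds                       ≡⟨ multiplicity-positive ds 0<d ⟨
  multiplicity d (positive ds)            ≡⟨ ∑-↭ _ (sort-↭ (positive ds)) ⟨
  multiplicity d (sort (positive ds))     ≡⟨ cong (multiplicity d) eq ⟩
  multiplicity d (positive (upTo n))      ≡⟨ multiplicity-positive (upTo n) 0<d ⟩
  multiplicity d (upTo n)                 ≡⟨ multiplicity-upTo d<n ⟩
  1                                       ∎
  where open ≡-Reasoning

atMostTwice-bySorting : ∀ {n} ds → sort (positive ds) ⊆ twice (upTo n) → ∀ d → 0 < d → d < n → multiplicity d ds ≤ 2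
atMostTwice-bySorting {n} ds sorted⊆ d 0<d d<n = begin
  multiplicity d ds                       ≡⟨ multiplicity-positive ds 0<d ⟨
  multiplicity d (positive ds)            ≡⟨ ∑-↭ _ (sort-↭ (positive ds)) ⟨
  multiplicity d (sort (positive ds))     ≤⟨ ∑-⊆ _ sorted⊆ ⟩
  multiplicity d (twice (upTo n))         ≡⟨ multiplicity-twice d (upTo n) ⟩
  2 * multiplicity d (upTo n)             ≡⟨ cong (2 *_) (multiplicity-upTo d<n) ⟩
  2                                       ∎
  where open ≤-Reasoning

unique? : ∀ {v n} (xs : Vec (Fin v) n) → Dec (Unique xs)
unique? = allPairs? (λ x y → ¬? (x ≟ y))

nestedBlock : ∀ {v k} (xs : Vec (Fin v) (suc k)) → Unique xs → NestedBlock v k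
nestedBlock (p ∷ A) unique-pA = nblock (block A (AllPairs.tail unique-pA)) p unique-pA

nestedBlocks : ∀ {v k} (L : List (Vec (Fin v) (suc k))) → All Unique L → List (NestedBlock v k)
nestedBlocks []       _        = []
nestedBlocks (xs ∷ L) unique-L = nestedBlock xs (All.head unique-L) ∷ nestedBlocks L (All.tail unique-L)

map-points-nestedBlocks : ∀ {v k} (L : List (Vec (Fin v) (suc k))) unique-L →
  map (pts ∘ blk) (nestedBlocks L unique-L) ≡ map tail L
map-points-nestedBlocks []            _        = refl
map-points-nestedBlocks ((p ∷ A) ∷ L) unique-L = cong (A ∷_) (map-points-nestedBlocks L (All.tail unique-L))

map-augmentedPoints-nestedBlocks : ∀ {v k} (L : List (Vec (Fin v) (suc k))) unique-L →
  map (pts ∘ augment) (nestedBlocks L unique-L) ≡ L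
map-augmentedPoints-nestedBlocks []            _        = refl
map-augmentedPoints-nestedBlocks ((p ∷ A) ∷ L) unique-L =
  cong ((p ∷ A) ∷_) (map-augmentedPoints-nestedBlocks L (All.tail unique-L))

module SubgroupOfOrder4 (q : ℕ) .{{_ : NonZero q}} where

  private instance
    4q≢0 : NonZero (4 * q)
    4q≢0 = m*n≢0 4 q

  open Cyclic (4 * q)

  quarterMultiples : Vec ℕ 4
  quarterMultiples = 0 ∷ q ∷ 2 * q ∷ 3 * q ∷ []

  subgroup : Vec (Fin (4 * q)) 4
  subgroup = mapᵛ (_mod (4 * q)) quarterMultiples

  nestedBIBD : (p : Fin (4 * q)) (L : List (Vec (Fin (4 * q)) 5)) →
    {distinct-L : True (All.all? unique? L)} →
    {distinct-S : True (unique? (p ∷ subgroup))} →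
    {rotation : True (≡-dec _≟_ (toList (mapᵛ (_+ᵗ q) subgroup)) (toList (tail subgroup) ∷ʳ head subgroup))} →
    {subgroup-differences : True (≡-dec ℕ._≟_ (sort (differences subgroup)) (sort (concat (replicate 4 (toList quarterMultiples)))))} →
    {exactlyOnce : True (≡-dec ℕ._≟_ (sort (positive (allDifferences (map tail L) ++ toList quarterMultiples)))
                                       (positive (upTo (4 * q))))} →
    {atMostTwice : True (sort (positive (allDifferences L ++ toList quarterMultiples ++ crossDifferences p subgroup))
                           ⊆? twice (upTo (4 * q)))} →
    NestedBIBDExists (4 * q) 4 1
  nestedBIBD p L {distinct-L} {distinct-S} {rotation} {subgroup-differences} {exactlyOnce} {atMostTwice} =
    design , design-isNestedBIBD plain-condition augmented-condition
    where
    unique-L = toWitness distinct-L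

    S+q↭S : toList (mapᵛ (_+ᵗ q) subgroup) ↭ toList subgroup
    S+q↭S = subst (_↭ toList subgroup) (sym (toWitness rotation)) (↭-sym (∷↭∷ʳ _ _))

    subgroup-multiplicities : ∀ d → multiplicity d (differences subgroup) ≡ 4 * multiplicity d (toList quarterMultiples)
    subgroup-multiplicities d = trans
      (∑-↭ (λ e → 𝟙 (d ℕ.≟ e))
        (↭-bySorting (differences subgroup) (concat (replicate 4 (toList quarterMultiples))) (toWitness subgroup-differences)))
      (multiplicity-concat-replicate d 4 (toList quarterMultiples))

    open ShortOrbitDesign (nestedBlocks L unique-L) (nestedBlock (p ∷ subgroup) (toWitness distinct-S)) 4 q refl S+q↭S
      (toList quarterMultiples) subgroup-multiplicities

    plain-condition : ∀ d → 0 < d → d < 4 * q → multiplicity d plainDifferences ≡ 1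
    plain-condition d 0<d d<v = trans
      (cong (λ As → multiplicity d (allDifferences As ++ toList quarterMultiples)) (map-points-nestedBlocks L unique-L))
      (exactlyOnce-bySorting (allDifferences (map tail L) ++ toList quarterMultiples) (toWitness exactlyOnce) d 0<d d<v)

    augmented-condition : ∀ d → 0 < d → d < 4 * q → multiplicity d augmentedDifferences ≤ 2
    augmented-condition d 0<d d<v = ≤-trans
      (≤-reflexive (cong (λ As → multiplicity d (allDifferences As ++ toList quarterMultiples ++ crossDifferences p subgroup))
                         (map-augmentedPoints-nestedBlocks L unique-L)))
      (atMostTwice-bySorting (allDifferences L ++ toList quarterMultiples ++ crossDifferences p subgroup) (toWitness atMostTwice) d 0<d d<v)

-- Each vector lists the nesting point of a base block followed by the block itself.

baseBlocks376 : List (Vec (Fin 376) 5)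
baseBlocks376 =
  (# 90 ∷ # 68 ∷ # 282 ∷ # 166 ∷ # 130 ∷ []) ∷
  (# 203 ∷ # 177 ∷ # 253 ∷ # 230 ∷ # 241 ∷ []) ∷
  (# 112 ∷ # 333 ∷ # 194 ∷ # 107 ∷ # 48 ∷ []) ∷
  (# 60 ∷ # 205 ∷ # 64 ∷ # 255 ∷ # 36 ∷ []) ∷
  (# 163 ∷ # 193 ∷ # 1 ∷ # 356 ∷ # 342 ∷ []) ∷
  (# 241 ∷ # 230 ∷ # 196 ∷ # 334 ∷ # 124 ∷ []) ∷
  (# 192 ∷ # 171 ∷ # 93 ∷ # 130 ∷ # 238 ∷ []) ∷
  (# 165 ∷ # 13 ∷ # 314 ∷ # 68 ∷ # 249 ∷ []) ∷
  (# 246 ∷ # 195 ∷ # 351 ∷ # 187 ∷ # 72 ∷ []) ∷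
  (# 48 ∷ # 371 ∷ # 14 ∷ # 270 ∷ # 80 ∷ []) ∷
  (# 205 ∷ # 224 ∷ # 134 ∷ # 46 ∷ # 119 ∷ []) ∷
  (# 267 ∷ # 340 ∷ # 186 ∷ # 260 ∷ # 192 ∷ []) ∷
  (# 241 ∷ # 254 ∷ # 52 ∷ # 72 ∷ # 311 ∷ []) ∷
  (# 156 ∷ # 284 ∷ # 158 ∷ # 347 ∷ # 114 ∷ []) ∷
  (# 326 ∷ # 220 ∷ # 65 ∷ # 175 ∷ # 334 ∷ []) ∷
  (# 341 ∷ # 170 ∷ # 369 ∷ # 374 ∷ # 256 ∷ []) ∷
  (# 365 ∷ # 145 ∷ # 9 ∷ # 273 ∷ # 264 ∷ []) ∷
  (# 228 ∷ # 244 ∷ # 145 ∷ # 234 ∷ # 141 ∷ []) ∷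
  (# 131 ∷ # 66 ∷ # 266 ∷ # 122 ∷ # 233 ∷ []) ∷
  (# 365 ∷ # 83 ∷ # 326 ∷ # 32 ∷ # 243 ∷ []) ∷
  (# 244 ∷ # 256 ∷ # 187 ∷ # 340 ∷ # 316 ∷ []) ∷
  (# 104 ∷ # 344 ∷ # 15 ∷ # 244 ∷ # 183 ∷ []) ∷
  (# 52 ∷ # 8 ∷ # 181 ∷ # 260 ∷ # 89 ∷ []) ∷
  (# 162 ∷ # 340 ∷ # 161 ∷ # 209 ∷ # 286 ∷ []) ∷
  (# 15 ∷ # 324 ∷ # 266 ∷ # 282 ∷ # 131 ∷ []) ∷
  (# 218 ∷ # 22 ∷ # 118 ∷ # 360 ∷ # 164 ∷ []) ∷
  (# 248 ∷ # 47 ∷ # 296 ∷ # 22 ∷ # 15 ∷ []) ∷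
  (# 332 ∷ # 88 ∷ # 86 ∷ # 89 ∷ # 59 ∷ []) ∷
  (# 291 ∷ # 183 ∷ # 131 ∷ # 170 ∷ # 61 ∷ []) ∷
  (# 352 ∷ # 180 ∷ # 140 ∷ # 211 ∷ # 162 ∷ []) ∷
  (# 102 ∷ # 154 ∷ # 180 ∷ # 312 ∷ # 137 ∷ []) ∷ []

baseBlocks388 : List (Vec (Fin 388) 5)
baseBlocks388 =
  (# 376 ∷ # 68 ∷ # 74 ∷ # 78 ∷ # 32 ∷ []) ∷
  (# 32 ∷ # 227 ∷ # 279 ∷ # 236 ∷ # 256 ∷ []) ∷
  (# 27 ∷ # 327 ∷ # 112 ∷ # 258 ∷ # 384 ∷ []) ∷
  (# 60 ∷ # 49 ∷ # 319 ∷ # 295 ∷ # 90 ∷ []) ∷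
  (# 344 ∷ # 311 ∷ # 324 ∷ # 233 ∷ # 356 ∷ []) ∷
  (# 230 ∷ # 27 ∷ # 32 ∷ # 198 ∷ # 257 ∷ []) ∷
  (# 368 ∷ # 9 ∷ # 67 ∷ # 304 ∷ # 244 ∷ []) ∷
  (# 115 ∷ # 47 ∷ # 162 ∷ # 270 ∷ # 281 ∷ []) ∷
  (# 53 ∷ # 259 ∷ # 204 ∷ # 14 ∷ # 154 ∷ []) ∷
  (# 144 ∷ # 241 ∷ # 84 ∷ # 206 ∷ # 272 ∷ []) ∷
  (# 141 ∷ # 224 ∷ # 208 ∷ # 29 ∷ # 384 ∷ []) ∷
  (# 270 ∷ # 229 ∷ # 155 ∷ # 368 ∷ # 361 ∷ []) ∷
  (# 14 ∷ # 11 ∷ # 362 ∷ # 175 ∷ # 213 ∷ []) ∷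
  (# 185 ∷ # 234 ∷ # 120 ∷ # 328 ∷ # 101 ∷ []) ∷
  (# 288 ∷ # 195 ∷ # 26 ∷ # 40 ∷ # 116 ∷ []) ∷
  (# 311 ∷ # 333 ∷ # 25 ∷ # 315 ∷ # 134 ∷ []) ∷
  (# 144 ∷ # 345 ∷ # 69 ∷ # 373 ∷ # 239 ∷ []) ∷
  (# 63 ∷ # 101 ∷ # 79 ∷ # 9 ∷ # 26 ∷ []) ∷
  (# 126 ∷ # 382 ∷ # 124 ∷ # 20 ∷ # 272 ∷ []) ∷
  (# 136 ∷ # 236 ∷ # 386 ∷ # 32 ∷ # 119 ∷ []) ∷
  (# 346 ∷ # 40 ∷ # 88 ∷ # 374 ∷ # 250 ∷ []) ∷
  (# 3 ∷ # 283 ∷ # 145 ∷ # 80 ∷ # 142 ∷ []) ∷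
  (# 302 ∷ # 226 ∷ # 155 ∷ # 153 ∷ # 70 ∷ []) ∷
  (# 59 ∷ # 312 ∷ # 327 ∷ # 6 ∷ # 226 ∷ []) ∷
  (# 207 ∷ # 370 ∷ # 369 ∷ # 241 ∷ # 281 ∷ []) ∷
  (# 15 ∷ # 175 ∷ # 286 ∷ # 72 ∷ # 347 ∷ []) ∷
  (# 101 ∷ # 9 ∷ # 341 ∷ # 53 ∷ # 316 ∷ []) ∷
  (# 13 ∷ # 71 ∷ # 218 ∷ # 122 ∷ # 267 ∷ []) ∷
  (# 332 ∷ # 112 ∷ # 219 ∷ # 207 ∷ # 180 ∷ []) ∷
  (# 251 ∷ # 230 ∷ # 63 ∷ # 374 ∷ # 33 ∷ []) ∷
  (# 177 ∷ # 183 ∷ # 162 ∷ # 314 ∷ # 63 ∷ []) ∷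
  (# 202 ∷ # 207 ∷ # 80 ∷ # 215 ∷ # 143 ∷ []) ∷ []

baseBlocks544 : List (Vec (Fin 544) 5)
baseBlocks544 =
  (# 243 ∷ # 373 ∷ # 524 ∷ # 122 ∷ # 210 ∷ []) ∷
  (# 264 ∷ # 82 ∷ # 55 ∷ # 417 ∷ # 466 ∷ []) ∷
  (# 449 ∷ # 475 ∷ # 167 ∷ # 84 ∷ # 148 ∷ []) ∷
  (# 542 ∷ # 349 ∷ # 304 ∷ # 269 ∷ # 380 ∷ []) ∷
  (# 298 ∷ # 472 ∷ # 395 ∷ # 51 ∷ # 93 ∷ []) ∷
  (# 520 ∷ # 362 ∷ # 368 ∷ # 196 ∷ # 156 ∷ []) ∷
  (# 86 ∷ # 308 ∷ # 272 ∷ # 218 ∷ # 399 ∷ []) ∷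
  (# 261 ∷ # 338 ∷ # 37 ∷ # 444 ∷ # 38 ∷ []) ∷
  (# 214 ∷ # 471 ∷ # 297 ∷ # 363 ∷ # 493 ∷ []) ∷
  (# 96 ∷ # 210 ∷ # 483 ∷ # 299 ∷ # 374 ∷ []) ∷
  (# 99 ∷ # 141 ∷ # 23 ∷ # 184 ∷ # 408 ∷ []) ∷
  (# 274 ∷ # 349 ∷ # 120 ∷ # 79 ∷ # 401 ∷ []) ∷
  (# 10 ∷ # 285 ∷ # 38 ∷ # 510 ∷ # 287 ∷ []) ∷
  (# 443 ∷ # 303 ∷ # 319 ∷ # 112 ∷ # 326 ∷ []) ∷
  (# 301 ∷ # 347 ∷ # 488 ∷ # 93 ∷ # 444 ∷ []) ∷
  (# 456 ∷ # 350 ∷ # 88 ∷ # 228 ∷ # 449 ∷ []) ∷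
  (# 272 ∷ # 524 ∷ # 527 ∷ # 337 ∷ # 398 ∷ []) ∷
  (# 234 ∷ # 264 ∷ # 230 ∷ # 183 ∷ # 216 ∷ []) ∷
  (# 519 ∷ # 338 ∷ # 342 ∷ # 111 ∷ # 122 ∷ []) ∷
  (# 121 ∷ # 255 ∷ # 540 ∷ # 199 ∷ # 372 ∷ []) ∷
  (# 120 ∷ # 276 ∷ # 408 ∷ # 101 ∷ # 434 ∷ []) ∷
  (# 22 ∷ # 286 ∷ # 448 ∷ # 341 ∷ # 411 ∷ []) ∷
  (# 424 ∷ # 314 ∷ # 2 ∷ # 399 ∷ # 81 ∷ []) ∷
  (# 9 ∷ # 148 ∷ # 497 ∷ # 242 ∷ # 292 ∷ []) ∷
  (# 180 ∷ # 116 ∷ # 350 ∷ # 484 ∷ # 14 ∷ []) ∷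
  (# 273 ∷ # 526 ∷ # 221 ∷ # 371 ∷ # 125 ∷ []) ∷
  (# 224 ∷ # 465 ∷ # 436 ∷ # 320 ∷ # 522 ∷ []) ∷
  (# 450 ∷ # 412 ∷ # 532 ∷ # 233 ∷ # 524 ∷ []) ∷
  (# 395 ∷ # 204 ∷ # 384 ∷ # 452 ∷ # 166 ∷ []) ∷
  (# 155 ∷ # 108 ∷ # 275 ∷ # 376 ∷ # 222 ∷ []) ∷
  (# 507 ∷ # 309 ∷ # 291 ∷ # 26 ∷ # 378 ∷ []) ∷
  (# 312 ∷ # 278 ∷ # 295 ∷ # 341 ∷ # 143 ∷ []) ∷
  (# 353 ∷ # 366 ∷ # 114 ∷ # 109 ∷ # 308 ∷ []) ∷
  (# 308 ∷ # 453 ∷ # 144 ∷ # 249 ∷ # 322 ∷ []) ∷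
  (# 206 ∷ # 209 ∷ # 99 ∷ # 21 ∷ # 540 ∷ []) ∷
  (# 470 ∷ # 273 ∷ # 7 ∷ # 332 ∷ # 430 ∷ []) ∷
  (# 296 ∷ # 364 ∷ # 236 ∷ # 351 ∷ # 464 ∷ []) ∷
  (# 22 ∷ # 542 ∷ # 282 ∷ # 13 ∷ # 254 ∷ []) ∷
  (# 282 ∷ # 313 ∷ # 220 ∷ # 397 ∷ # 417 ∷ []) ∷
  (# 83 ∷ # 3 ∷ # 391 ∷ # 85 ∷ # 537 ∷ []) ∷
  (# 166 ∷ # 118 ∷ # 130 ∷ # 79 ∷ # 139 ∷ []) ∷
  (# 494 ∷ # 455 ∷ # 50 ∷ # 393 ∷ # 423 ∷ []) ∷
  (# 238 ∷ # 311 ∷ # 496 ∷ # 122 ∷ # 246 ∷ []) ∷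
  (# 433 ∷ # 512 ∷ # 183 ∷ # 116 ∷ # 302 ∷ []) ∷
  (# 512 ∷ # 308 ∷ # 403 ∷ # 379 ∷ # 139 ∷ []) ∷ []

baseBlocks556 : List (Vec (Fin 556) 5)
baseBlocks556 =
  (# 208 ∷ # 217 ∷ # 295 ∷ # 42 ∷ # 339 ∷ []) ∷
  (# 114 ∷ # 89 ∷ # 446 ∷ # 117 ∷ # 299 ∷ []) ∷
  (# 431 ∷ # 197 ∷ # 348 ∷ # 512 ∷ # 230 ∷ []) ∷
  (# 512 ∷ # 399 ∷ # 107 ∷ # 5 ∷ # 456 ∷ []) ∷
  (# 406 ∷ # 480 ∷ # 387 ∷ # 485 ∷ # 355 ∷ []) ∷
  (# 460 ∷ # 433 ∷ # 18 ∷ # 69 ∷ # 504 ∷ []) ∷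
  (# 316 ∷ # 450 ∷ # 46 ∷ # 216 ∷ # 27 ∷ []) ∷
  (# 363 ∷ # 90 ∷ # 496 ∷ # 227 ∷ # 448 ∷ []) ∷
  (# 263 ∷ # 55 ∷ # 45 ∷ # 172 ∷ # 109 ∷ []) ∷
  (# 509 ∷ # 224 ∷ # 470 ∷ # 22 ∷ # 436 ∷ []) ∷
  (# 513 ∷ # 161 ∷ # 198 ∷ # 526 ∷ # 550 ∷ []) ∷
  (# 26 ∷ # 34 ∷ # 432 ∷ # 251 ∷ # 524 ∷ []) ∷
  (# 399 ∷ # 66 ∷ # 413 ∷ # 310 ∷ # 297 ∷ []) ∷
  (# 210 ∷ # 82 ∷ # 88 ∷ # 162 ∷ # 109 ∷ []) ∷
  (# 2 ∷ # 414 ∷ # 157 ∷ # 466 ∷ # 142 ∷ []) ∷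
  (# 282 ∷ # 192 ∷ # 281 ∷ # 232 ∷ # 88 ∷ []) ∷
  (# 272 ∷ # 116 ∷ # 420 ∷ # 197 ∷ # 459 ∷ []) ∷
  (# 234 ∷ # 533 ∷ # 353 ∷ # 196 ∷ # 379 ∷ []) ∷
  (# 524 ∷ # 30 ∷ # 452 ∷ # 44 ∷ # 540 ∷ []) ∷
  (# 324 ∷ # 312 ∷ # 27 ∷ # 138 ∷ # 354 ∷ []) ∷
  (# 340 ∷ # 286 ∷ # 270 ∷ # 288 ∷ # 508 ∷ []) ∷
  (# 517 ∷ # 237 ∷ # 175 ∷ # 60 ∷ # 172 ∷ []) ∷
  (# 335 ∷ # 361 ∷ # 0 ∷ # 91 ∷ # 447 ∷ []) ∷
  (# 330 ∷ # 275 ∷ # 234 ∷ # 26 ∷ # 19 ∷ []) ∷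
  (# 9 ∷ # 318 ∷ # 424 ∷ # 198 ∷ # 27 ∷ []) ∷
  (# 499 ∷ # 411 ∷ # 336 ∷ # 361 ∷ # 208 ∷ []) ∷
  (# 221 ∷ # 59 ∷ # 484 ∷ # 47 ∷ # 531 ∷ []) ∷
  (# 432 ∷ # 89 ∷ # 303 ∷ # 85 ∷ # 339 ∷ []) ∷
  (# 327 ∷ # 188 ∷ # 197 ∷ # 98 ∷ # 1 ∷ []) ∷
  (# 540 ∷ # 391 ∷ # 460 ∷ # 383 ∷ # 215 ∷ []) ∷
  (# 227 ∷ # 195 ∷ # 85 ∷ # 17 ∷ # 250 ∷ []) ∷
  (# 84 ∷ # 6 ∷ # 89 ∷ # 319 ∷ # 51 ∷ []) ∷
  (# 168 ∷ # 45 ∷ # 139 ∷ # 285 ∷ # 540 ∷ []) ∷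
  (# 226 ∷ # 361 ∷ # 555 ∷ # 160 ∷ # 260 ∷ []) ∷
  (# 353 ∷ # 89 ∷ # 479 ∷ # 30 ∷ # 457 ∷ []) ∷
  (# 236 ∷ # 283 ∷ # 240 ∷ # 104 ∷ # 260 ∷ []) ∷
  (# 224 ∷ # 281 ∷ # 444 ∷ # 2 ∷ # 529 ∷ []) ∷
  (# 246 ∷ # 121 ∷ # 34 ∷ # 417 ∷ # 452 ∷ []) ∷
  (# 296 ∷ # 237 ∷ # 77 ∷ # 488 ∷ # 316 ∷ []) ∷
  (# 22 ∷ # 137 ∷ # 418 ∷ # 435 ∷ # 11 ∷ []) ∷
  (# 146 ∷ # 520 ∷ # 351 ∷ # 37 ∷ # 407 ∷ []) ∷
  (# 533 ∷ # 167 ∷ # 518 ∷ # 307 ∷ # 225 ∷ []) ∷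
  (# 184 ∷ # 6 ∷ # 149 ∷ # 439 ∷ # 73 ∷ []) ∷
  (# 303 ∷ # 7 ∷ # 131 ∷ # 366 ∷ # 142 ∷ []) ∷
  (# 199 ∷ # 26 ∷ # 398 ∷ # 397 ∷ # 302 ∷ []) ∷
  (# 385 ∷ # 185 ∷ # 452 ∷ # 421 ∷ # 215 ∷ []) ∷ []

baseBlocks568 : List (Vec (Fin 568) 5)
baseBlocks568 =
  (# 413 ∷ # 371 ∷ # 188 ∷ # 214 ∷ # 203 ∷ []) ∷
  (# 52 ∷ # 328 ∷ # 375 ∷ # 351 ∷ # 282 ∷ []) ∷
  (# 261 ∷ # 76 ∷ # 108 ∷ # 279 ∷ # 346 ∷ []) ∷
  (# 258 ∷ # 131 ∷ # 70 ∷ # 346 ∷ # 260 ∷ []) ∷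
  (# 507 ∷ # 452 ∷ # 490 ∷ # 72 ∷ # 294 ∷ []) ∷
  (# 332 ∷ # 440 ∷ # 101 ∷ # 20 ∷ # 475 ∷ []) ∷
  (# 483 ∷ # 442 ∷ # 461 ∷ # 512 ∷ # 218 ∷ []) ∷
  (# 343 ∷ # 276 ∷ # 151 ∷ # 422 ∷ # 273 ∷ []) ∷
  (# 49 ∷ # 511 ∷ # 559 ∷ # 311 ∷ # 193 ∷ []) ∷
  (# 96 ∷ # 69 ∷ # 543 ∷ # 545 ∷ # 368 ∷ []) ∷
  (# 475 ∷ # 18 ∷ # 388 ∷ # 184 ∷ # 180 ∷ []) ∷
  (# 27 ∷ # 24 ∷ # 165 ∷ # 429 ∷ # 512 ∷ []) ∷
  (# 178 ∷ # 229 ∷ # 340 ∷ # 333 ∷ # 553 ∷ []) ∷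
  (# 524 ∷ # 562 ∷ # 231 ∷ # 390 ∷ # 283 ∷ []) ∷
  (# 217 ∷ # 564 ∷ # 311 ∷ # 437 ∷ # 16 ∷ []) ∷
  (# 169 ∷ # 326 ∷ # 161 ∷ # 251 ∷ # 482 ∷ []) ∷
  (# 379 ∷ # 94 ∷ # 345 ∷ # 209 ∷ # 333 ∷ []) ∷
  (# 164 ∷ # 235 ∷ # 19 ∷ # 119 ∷ # 133 ∷ []) ∷
  (# 227 ∷ # 454 ∷ # 394 ∷ # 257 ∷ # 395 ∷ []) ∷
  (# 325 ∷ # 277 ∷ # 421 ∷ # 169 ∷ # 160 ∷ []) ∷
  (# 378 ∷ # 16 ∷ # 339 ∷ # 84 ∷ # 6 ∷ []) ∷
  (# 40 ∷ # 113 ∷ # 34 ∷ # 448 ∷ # 121 ∷ []) ∷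
  (# 327 ∷ # 447 ∷ # 404 ∷ # 476 ∷ # 9 ∷ []) ∷
  (# 554 ∷ # 519 ∷ # 544 ∷ # 312 ∷ # 374 ∷ []) ∷
  (# 26 ∷ # 561 ∷ # 14 ∷ # 479 ∷ # 462 ∷ []) ∷
  (# 138 ∷ # 364 ∷ # 543 ∷ # 15 ∷ # 448 ∷ []) ∷
  (# 527 ∷ # 276 ∷ # 75 ∷ # 352 ∷ # 166 ∷ []) ∷
  (# 257 ∷ # 24 ∷ # 250 ∷ # 461 ∷ # 411 ∷ []) ∷
  (# 241 ∷ # 278 ∷ # 336 ∷ # 169 ∷ # 127 ∷ []) ∷
  (# 251 ∷ # 19 ∷ # 72 ∷ # 373 ∷ # 551 ∷ []) ∷
  (# 81 ∷ # 362 ∷ # 156 ∷ # 210 ∷ # 542 ∷ []) ∷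
  (# 448 ∷ # 462 ∷ # 398 ∷ # 357 ∷ # 234 ∷ []) ∷
  (# 507 ∷ # 446 ∷ # 158 ∷ # 441 ∷ # 229 ∷ []) ∷
  (# 566 ∷ # 474 ∷ # 232 ∷ # 216 ∷ # 408 ∷ []) ∷
  (# 49 ∷ # 153 ∷ # 285 ∷ # 440 ∷ # 251 ∷ []) ∷
  (# 149 ∷ # 189 ∷ # 501 ∷ # 373 ∷ # 124 ∷ []) ∷
  (# 236 ∷ # 259 ∷ # 537 ∷ # 524 ∷ # 493 ∷ []) ∷
  (# 224 ∷ # 27 ∷ # 539 ∷ # 124 ∷ # 396 ∷ []) ∷
  (# 470 ∷ # 506 ∷ # 231 ∷ # 44 ∷ # 204 ∷ []) ∷
  (# 296 ∷ # 206 ∷ # 280 ∷ # 401 ∷ # 87 ∷ []) ∷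
  (# 224 ∷ # 50 ∷ # 268 ∷ # 83 ∷ # 313 ∷ []) ∷
  (# 367 ∷ # 561 ∷ # 42 ∷ # 476 ∷ # 302 ∷ []) ∷
  (# 284 ∷ # 123 ∷ # 101 ∷ # 423 ∷ # 95 ∷ []) ∷
  (# 11 ∷ # 249 ∷ # 80 ∷ # 560 ∷ # 219 ∷ []) ∷
  (# 303 ∷ # 81 ∷ # 44 ∷ # 387 ∷ # 177 ∷ []) ∷
  (# 153 ∷ # 322 ∷ # 210 ∷ # 265 ∷ # 283 ∷ []) ∷
  (# 340 ∷ # 531 ∷ # 308 ∷ # 103 ∷ # 26 ∷ []) ∷ []

baseBlocks580 : List (Vec (Fin 580) 5)
baseBlocks580 =
  (# 137 ∷ # 20 ∷ # 76 ∷ # 477 ∷ # 562 ∷ []) ∷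
  (# 64 ∷ # 16 ∷ # 394 ∷ # 359 ∷ # 571 ∷ []) ∷
  (# 283 ∷ # 328 ∷ # 390 ∷ # 14 ∷ # 282 ∷ []) ∷
  (# 120 ∷ # 467 ∷ # 320 ∷ # 247 ∷ # 430 ∷ []) ∷
  (# 507 ∷ # 540 ∷ # 100 ∷ # 119 ∷ # 187 ∷ []) ∷
  (# 408 ∷ # 354 ∷ # 493 ∷ # 421 ∷ # 278 ∷ []) ∷
  (# 420 ∷ # 134 ∷ # 267 ∷ # 545 ∷ # 415 ∷ []) ∷
  (# 471 ∷ # 48 ∷ # 393 ∷ # 232 ∷ # 204 ∷ []) ∷
  (# 214 ∷ # 105 ∷ # 442 ∷ # 24 ∷ # 497 ∷ []) ∷
  (# 442 ∷ # 436 ∷ # 53 ∷ # 336 ∷ # 245 ∷ []) ∷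
  (# 517 ∷ # 75 ∷ # 251 ∷ # 350 ∷ # 544 ∷ []) ∷
  (# 29 ∷ # 422 ∷ # 249 ∷ # 96 ∷ # 98 ∷ []) ∷
  (# 247 ∷ # 250 ∷ # 126 ∷ # 230 ∷ # 63 ∷ []) ∷
  (# 443 ∷ # 4 ∷ # 226 ∷ # 427 ∷ # 338 ∷ []) ∷
  (# 395 ∷ # 119 ∷ # 351 ∷ # 237 ∷ # 261 ∷ []) ∷
  (# 456 ∷ # 213 ∷ # 195 ∷ # 35 ∷ # 551 ∷ []) ∷
  (# 482 ∷ # 204 ∷ # 170 ∷ # 320 ∷ # 386 ∷ []) ∷
  (# 114 ∷ # 128 ∷ # 378 ∷ # 448 ∷ # 171 ∷ []) ∷
  (# 104 ∷ # 84 ∷ # 538 ∷ # 144 ∷ # 469 ∷ []) ∷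
  (# 149 ∷ # 26 ∷ # 16 ∷ # 160 ∷ # 493 ∷ []) ∷
  (# 204 ∷ # 568 ∷ # 1 ∷ # 574 ∷ # 253 ∷ []) ∷
  (# 22 ∷ # 202 ∷ # 34 ∷ # 166 ∷ # 451 ∷ []) ∷
  (# 375 ∷ # 529 ∷ # 579 ∷ # 281 ∷ # 295 ∷ []) ∷
  (# 554 ∷ # 428 ∷ # 299 ∷ # 340 ∷ # 520 ∷ []) ∷
  (# 545 ∷ # 12 ∷ # 282 ∷ # 42 ∷ # 217 ∷ []) ∷
  (# 390 ∷ # 214 ∷ # 215 ∷ # 564 ∷ # 272 ∷ []) ∷
  (# 432 ∷ # 8 ∷ # 548 ∷ # 225 ∷ # 221 ∷ []) ∷
  (# 30 ∷ # 391 ∷ # 352 ∷ # 369 ∷ # 506 ∷ []) ∷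
  (# 368 ∷ # 318 ∷ # 223 ∷ # 372 ∷ # 503 ∷ []) ∷
  (# 181 ∷ # 143 ∷ # 90 ∷ # 111 ∷ # 369 ∷ []) ∷
  (# 93 ∷ # 471 ∷ # 419 ∷ # 261 ∷ # 442 ∷ []) ∷
  (# 507 ∷ # 347 ∷ # 40 ∷ # 543 ∷ # 344 ∷ []) ∷
  (# 382 ∷ # 425 ∷ # 83 ∷ # 161 ∷ # 354 ∷ []) ∷
  (# 181 ∷ # 487 ∷ # 34 ∷ # 45 ∷ # 273 ∷ []) ∷
  (# 38 ∷ # 45 ∷ # 120 ∷ # 40 ∷ # 89 ∷ []) ∷
  (# 86 ∷ # 343 ∷ # 14 ∷ # 429 ∷ # 331 ∷ []) ∷
  (# 134 ∷ # 452 ∷ # 81 ∷ # 577 ∷ # 425 ∷ []) ∷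
  (# 138 ∷ # 557 ∷ # 82 ∷ # 541 ∷ # 97 ∷ []) ∷
  (# 551 ∷ # 300 ∷ # 541 ∷ # 533 ∷ # 333 ∷ []) ∷
  (# 222 ∷ # 354 ∷ # 82 ∷ # 560 ∷ # 183 ∷ []) ∷
  (# 505 ∷ # 353 ∷ # 270 ∷ # 481 ∷ # 47 ∷ []) ∷
  (# 162 ∷ # 76 ∷ # 394 ∷ # 301 ∷ # 343 ∷ []) ∷
  (# 102 ∷ # 117 ∷ # 226 ∷ # 252 ∷ # 178 ∷ []) ∷
  (# 142 ∷ # 430 ∷ # 111 ∷ # 536 ∷ # 527 ∷ []) ∷
  (# 539 ∷ # 138 ∷ # 520 ∷ # 185 ∷ # 19 ∷ []) ∷
  (# 123 ∷ # 15 ∷ # 234 ∷ # 189 ∷ # 478 ∷ []) ∷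
  (# 202 ∷ # 429 ∷ # 160 ∷ # 570 ∷ # 511 ∷ []) ∷
  (# 269 ∷ # 291 ∷ # 463 ∷ # 169 ∷ # 73 ∷ []) ∷ []

baseBlocks880 : List (Vec (Fin 880) 5)
baseBlocks880 =
  (# 720 ∷ # 273 ∷ # 86 ∷ # 327 ∷ # 25 ∷ []) ∷
  (# 92 ∷ # 856 ∷ # 775 ∷ # 76 ∷ # 155 ∷ []) ∷
  (# 867 ∷ # 779 ∷ # 635 ∷ # 1 ∷ # 397 ∷ []) ∷
  (# 821 ∷ # 63 ∷ # 814 ∷ # 643 ∷ # 167 ∷ []) ∷
  (# 782 ∷ # 767 ∷ # 139 ∷ # 262 ∷ # 191 ∷ []) ∷
  (# 728 ∷ # 148 ∷ # 666 ∷ # 82 ∷ # 525 ∷ []) ∷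
  (# 261 ∷ # 528 ∷ # 385 ∷ # 481 ∷ # 518 ∷ []) ∷
  (# 551 ∷ # 190 ∷ # 532 ∷ # 556 ∷ # 73 ∷ []) ∷
  (# 236 ∷ # 233 ∷ # 156 ∷ # 831 ∷ # 413 ∷ []) ∷
  (# 879 ∷ # 824 ∷ # 615 ∷ # 607 ∷ # 858 ∷ []) ∷
  (# 364 ∷ # 389 ∷ # 181 ∷ # 103 ∷ # 62 ∷ []) ∷
  (# 444 ∷ # 74 ∷ # 546 ∷ # 339 ∷ # 542 ∷ []) ∷
  (# 288 ∷ # 121 ∷ # 114 ∷ # 505 ∷ # 484 ∷ []) ∷
  (# 388 ∷ # 337 ∷ # 78 ∷ # 229 ∷ # 657 ∷ []) ∷
  (# 807 ∷ # 586 ∷ # 267 ∷ # 425 ∷ # 701 ∷ []) ∷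
  (# 30 ∷ # 190 ∷ # 671 ∷ # 130 ∷ # 424 ∷ []) ∷
  (# 711 ∷ # 172 ∷ # 270 ∷ # 346 ∷ # 802 ∷ []) ∷
  (# 499 ∷ # 668 ∷ # 324 ∷ # 646 ∷ # 741 ∷ []) ∷
  (# 792 ∷ # 722 ∷ # 532 ∷ # 317 ∷ # 654 ∷ []) ∷
  (# 855 ∷ # 233 ∷ # 319 ∷ # 321 ∷ # 606 ∷ []) ∷
  (# 530 ∷ # 31 ∷ # 681 ∷ # 59 ∷ # 320 ∷ []) ∷
  (# 443 ∷ # 5 ∷ # 177 ∷ # 656 ∷ # 249 ∷ []) ∷
  (# 650 ∷ # 169 ∷ # 337 ∷ # 126 ∷ # 275 ∷ []) ∷
  (# 113 ∷ # 870 ∷ # 703 ∷ # 121 ∷ # 281 ∷ []) ∷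
  (# 33 ∷ # 367 ∷ # 799 ∷ # 53 ∷ # 407 ∷ []) ∷
  (# 596 ∷ # 448 ∷ # 613 ∷ # 69 ∷ # 598 ∷ []) ∷
  (# 817 ∷ # 210 ∷ # 674 ∷ # 248 ∷ # 303 ∷ []) ∷
  (# 99 ∷ # 651 ∷ # 206 ∷ # 226 ∷ # 754 ∷ []) ∷
  (# 726 ∷ # 758 ∷ # 64 ∷ # 90 ∷ # 725 ∷ []) ∷
  (# 220 ∷ # 242 ∷ # 184 ∷ # 497 ∷ # 44 ∷ []) ∷
  (# 705 ∷ # 818 ∷ # 830 ∷ # 273 ∷ # 164 ∷ []) ∷
  (# 234 ∷ # 799 ∷ # 626 ∷ # 742 ∷ # 427 ∷ []) ∷
  (# 2 ∷ # 805 ∷ # 531 ∷ # 339 ∷ # 191 ∷ []) ∷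
  (# 104 ∷ # 597 ∷ # 219 ∷ # 60 ∷ # 74 ∷ []) ∷
  (# 325 ∷ # 229 ∷ # 94 ∷ # 319 ∷ # 181 ∷ []) ∷
  (# 340 ∷ # 77 ∷ # 432 ∷ # 293 ∷ # 735 ∷ []) ∷
  (# 22 ∷ # 139 ∷ # 395 ∷ # 339 ∷ # 570 ∷ []) ∷
  (# 26 ∷ # 583 ∷ # 858 ∷ # 761 ∷ # 499 ∷ []) ∷
  (# 665 ∷ # 619 ∷ # 463 ∷ # 259 ∷ # 744 ∷ []) ∷
  (# 0 ∷ # 426 ∷ # 26 ∷ # 158 ∷ # 455 ∷ []) ∷
  (# 551 ∷ # 856 ∷ # 593 ∷ # 447 ∷ # 340 ∷ []) ∷
  (# 404 ∷ # 128 ∷ # 79 ∷ # 724 ∷ # 854 ∷ []) ∷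
  (# 872 ∷ # 335 ∷ # 771 ∷ # 310 ∷ # 133 ∷ []) ∷
  (# 221 ∷ # 600 ∷ # 118 ∷ # 255 ∷ # 766 ∷ []) ∷
  (# 6 ∷ # 392 ∷ # 391 ∷ # 662 ∷ # 74 ∷ []) ∷
  (# 729 ∷ # 144 ∷ # 208 ∷ # 475 ∷ # 384 ∷ []) ∷
  (# 29 ∷ # 229 ∷ # 309 ∷ # 615 ∷ # 259 ∷ []) ∷
  (# 90 ∷ # 52 ∷ # 7 ∷ # 769 ∷ # 599 ∷ []) ∷
  (# 227 ∷ # 472 ∷ # 200 ∷ # 699 ∷ # 690 ∷ []) ∷
  (# 45 ∷ # 859 ∷ # 512 ∷ # 466 ∷ # 776 ∷ []) ∷
  (# 448 ∷ # 110 ∷ # 826 ∷ # 751 ∷ # 59 ∷ []) ∷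
  (# 507 ∷ # 478 ∷ # 662 ∷ # 588 ∷ # 111 ∷ []) ∷
  (# 377 ∷ # 23 ∷ # 58 ∷ # 604 ∷ # 408 ∷ []) ∷
  (# 2 ∷ # 578 ∷ # 158 ∷ # 730 ∷ # 252 ∷ []) ∷
  (# 340 ∷ # 26 ∷ # 220 ∷ # 305 ∷ # 817 ∷ []) ∷
  (# 400 ∷ # 599 ∷ # 616 ∷ # 205 ∷ # 546 ∷ []) ∷
  (# 488 ∷ # 702 ∷ # 32 ∷ # 187 ∷ # 378 ∷ []) ∷
  (# 497 ∷ # 573 ∷ # 550 ∷ # 257 ∷ # 506 ∷ []) ∷
  (# 62 ∷ # 578 ∷ # 253 ∷ # 250 ∷ # 562 ∷ []) ∷
  (# 790 ∷ # 42 ∷ # 780 ∷ # 721 ∷ # 786 ∷ []) ∷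
  (# 660 ∷ # 732 ∷ # 575 ∷ # 352 ∷ # 701 ∷ []) ∷
  (# 22 ∷ # 829 ∷ # 623 ∷ # 634 ∷ # 441 ∷ []) ∷
  (# 799 ∷ # 12 ∷ # 668 ∷ # 399 ∷ # 126 ∷ []) ∷
  (# 798 ∷ # 156 ∷ # 384 ∷ # 345 ∷ # 758 ∷ []) ∷
  (# 569 ∷ # 317 ∷ # 479 ∷ # 756 ∷ # 774 ∷ []) ∷
  (# 595 ∷ # 538 ∷ # 302 ∷ # 414 ∷ # 735 ∷ []) ∷
  (# 662 ∷ # 575 ∷ # 686 ∷ # 533 ∷ # 406 ∷ []) ∷
  (# 677 ∷ # 524 ∷ # 593 ∷ # 20 ∷ # 511 ∷ []) ∷
  (# 741 ∷ # 644 ∷ # 69 ∷ # 543 ∷ # 764 ∷ []) ∷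
  (# 669 ∷ # 611 ∷ # 548 ∷ # 258 ∷ # 512 ∷ []) ∷
  (# 123 ∷ # 420 ∷ # 415 ∷ # 447 ∷ # 830 ∷ []) ∷
  (# 62 ∷ # 129 ∷ # 772 ∷ # 651 ∷ # 559 ∷ []) ∷
  (# 340 ∷ # 709 ∷ # 562 ∷ # 379 ∷ # 690 ∷ []) ∷ []

baseBlocks892 : List (Vec (Fin 892) 5)
baseBlocks892 =
  (# 387 ∷ # 691 ∷ # 102 ∷ # 56 ∷ # 651 ∷ []) ∷
  (# 582 ∷ # 465 ∷ # 651 ∷ # 81 ∷ # 695 ∷ []) ∷
  (# 8 ∷ # 491 ∷ # 805 ∷ # 702 ∷ # 374 ∷ []) ∷
  (# 98 ∷ # 874 ∷ # 63 ∷ # 284 ∷ # 35 ∷ []) ∷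
  (# 782 ∷ # 41 ∷ # 499 ∷ # 31 ∷ # 613 ∷ []) ∷
  (# 412 ∷ # 215 ∷ # 124 ∷ # 782 ∷ # 430 ∷ []) ∷
  (# 164 ∷ # 120 ∷ # 358 ∷ # 332 ∷ # 450 ∷ []) ∷
  (# 120 ∷ # 584 ∷ # 661 ∷ # 889 ∷ # 248 ∷ []) ∷
  (# 507 ∷ # 710 ∷ # 188 ∷ # 881 ∷ # 713 ∷ []) ∷
  (# 573 ∷ # 618 ∷ # 763 ∷ # 353 ∷ # 669 ∷ []) ∷
  (# 216 ∷ # 623 ∷ # 288 ∷ # 510 ∷ # 568 ∷ []) ∷
  (# 483 ∷ # 325 ∷ # 544 ∷ # 424 ∷ # 107 ∷ []) ∷
  (# 200 ∷ # 554 ∷ # 438 ∷ # 799 ∷ # 391 ∷ []) ∷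
  (# 325 ∷ # 335 ∷ # 297 ∷ # 478 ∷ # 115 ∷ []) ∷
  (# 81 ∷ # 628 ∷ # 724 ∷ # 78 ∷ # 803 ∷ []) ∷
  (# 413 ∷ # 115 ∷ # 770 ∷ # 695 ∷ # 507 ∷ []) ∷
  (# 258 ∷ # 557 ∷ # 40 ∷ # 749 ∷ # 591 ∷ []) ∷
  (# 190 ∷ # 36 ∷ # 456 ∷ # 620 ∷ # 754 ∷ []) ∷
  (# 511 ∷ # 551 ∷ # 447 ∷ # 461 ∷ # 17 ∷ []) ∷
  (# 811 ∷ # 95 ∷ # 138 ∷ # 560 ∷ # 531 ∷ []) ∷
  (# 782 ∷ # 447 ∷ # 15 ∷ # 443 ∷ # 850 ∷ []) ∷
  (# 443 ∷ # 733 ∷ # 734 ∷ # 294 ∷ # 859 ∷ []) ∷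
  (# 328 ∷ # 851 ∷ # 336 ∷ # 149 ∷ # 480 ∷ []) ∷
  (# 780 ∷ # 789 ∷ # 845 ∷ # 147 ∷ # 800 ∷ []) ∷
  (# 528 ∷ # 129 ∷ # 807 ∷ # 356 ∷ # 362 ∷ []) ∷
  (# 443 ∷ # 814 ∷ # 513 ∷ # 389 ∷ # 0 ∷ []) ∷
  (# 712 ∷ # 286 ∷ # 32 ∷ # 372 ∷ # 34 ∷ []) ∷
  (# 186 ∷ # 496 ∷ # 366 ∷ # 390 ∷ # 764 ∷ []) ∷
  (# 327 ∷ # 730 ∷ # 561 ∷ # 112 ∷ # 404 ∷ []) ∷
  (# 738 ∷ # 302 ∷ # 146 ∷ # 794 ∷ # 430 ∷ []) ∷
  (# 821 ∷ # 153 ∷ # 699 ∷ # 504 ∷ # 869 ∷ []) ∷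
  (# 305 ∷ # 745 ∷ # 695 ∷ # 312 ∷ # 478 ∷ []) ∷
  (# 605 ∷ # 418 ∷ # 220 ∷ # 59 ∷ # 349 ∷ []) ∷
  (# 93 ∷ # 452 ∷ # 177 ∷ # 292 ∷ # 159 ∷ []) ∷
  (# 10 ∷ # 759 ∷ # 784 ∷ # 743 ∷ # 236 ∷ []) ∷
  (# 31 ∷ # 336 ∷ # 686 ∷ # 602 ∷ # 837 ∷ []) ∷
  (# 22 ∷ # 230 ∷ # 109 ∷ # 141 ∷ # 503 ∷ []) ∷
  (# 879 ∷ # 843 ∷ # 487 ∷ # 164 ∷ # 389 ∷ []) ∷
  (# 665 ∷ # 116 ∷ # 316 ∷ # 243 ∷ # 398 ∷ []) ∷
  (# 554 ∷ # 447 ∷ # 354 ∷ # 282 ∷ # 434 ∷ []) ∷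
  (# 66 ∷ # 787 ∷ # 765 ∷ # 433 ∷ # 848 ∷ []) ∷
  (# 676 ∷ # 465 ∷ # 577 ∷ # 209 ∷ # 161 ∷ []) ∷
  (# 44 ∷ # 689 ∷ # 378 ∷ # 558 ∷ # 448 ∷ []) ∷
  (# 221 ∷ # 262 ∷ # 58 ∷ # 254 ∷ # 745 ∷ []) ∷
  (# 432 ∷ # 158 ∷ # 70 ∷ # 773 ∷ # 267 ∷ []) ∷
  (# 264 ∷ # 859 ∷ # 438 ∷ # 864 ∷ # 285 ∷ []) ∷
  (# 723 ∷ # 495 ∷ # 341 ∷ # 376 ∷ # 236 ∷ []) ∷
  (# 540 ∷ # 277 ∷ # 270 ∷ # 674 ∷ # 319 ∷ []) ∷
  (# 22 ∷ # 656 ∷ # 882 ∷ # 679 ∷ # 477 ∷ []) ∷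
  (# 697 ∷ # 449 ∷ # 413 ∷ # 92 ∷ # 713 ∷ []) ∷
  (# 199 ∷ # 404 ∷ # 95 ∷ # 711 ∷ # 611 ∷ []) ∷
  (# 507 ∷ # 230 ∷ # 57 ∷ # 862 ∷ # 882 ∷ []) ∷
  (# 512 ∷ # 825 ∷ # 329 ∷ # 299 ∷ # 320 ∷ []) ∷
  (# 786 ∷ # 869 ∷ # 626 ∷ # 888 ∷ # 659 ∷ []) ∷
  (# 353 ∷ # 835 ∷ # 215 ∷ # 323 ∷ # 501 ∷ []) ∷
  (# 437 ∷ # 322 ∷ # 667 ∷ # 733 ∷ # 875 ∷ []) ∷
  (# 693 ∷ # 124 ∷ # 807 ∷ # 62 ∷ # 635 ∷ []) ∷
  (# 224 ∷ # 399 ∷ # 862 ∷ # 258 ∷ # 630 ∷ []) ∷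
  (# 779 ∷ # 722 ∷ # 637 ∷ # 308 ∷ # 431 ∷ []) ∷
  (# 470 ∷ # 334 ∷ # 751 ∷ # 853 ∷ # 349 ∷ []) ∷
  (# 454 ∷ # 345 ∷ # 889 ∷ # 477 ∷ # 536 ∷ []) ∷
  (# 414 ∷ # 592 ∷ # 888 ∷ # 415 ∷ # 793 ∷ []) ∷
  (# 426 ∷ # 826 ∷ # 565 ∷ # 758 ∷ # 704 ∷ []) ∷
  (# 303 ∷ # 809 ∷ # 28 ∷ # 485 ∷ # 67 ∷ []) ∷
  (# 569 ∷ # 645 ∷ # 152 ∷ # 662 ∷ # 6 ∷ []) ∷
  (# 657 ∷ # 633 ∷ # 696 ∷ # 448 ∷ # 417 ∷ []) ∷
  (# 678 ∷ # 200 ∷ # 455 ∷ # 845 ∷ # 697 ∷ []) ∷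
  (# 190 ∷ # 781 ∷ # 643 ∷ # 717 ∷ # 744 ∷ []) ∷
  (# 644 ∷ # 179 ∷ # 231 ∷ # 790 ∷ # 82 ∷ []) ∷
  (# 514 ∷ # 830 ∷ # 275 ∷ # 287 ∷ # 545 ∷ []) ∷
  (# 857 ∷ # 845 ∷ # 551 ∷ # 710 ∷ # 268 ∷ []) ∷
  (# 221 ∷ # 465 ∷ # 196 ∷ # 59 ∷ # 358 ∷ []) ∷
  (# 436 ∷ # 92 ∷ # 689 ∷ # 624 ∷ # 21 ∷ []) ∷
  (# 601 ∷ # 420 ∷ # 73 ∷ # 496 ∷ # 360 ∷ []) ∷ []

baseBlocks1120 : List (Vec (Fin 1120) 5)
baseBlocks1120 =
  (# 331 ∷ # 956 ∷ # 127 ∷ # 183 ∷ # 249 ∷ []) ∷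
  (# 128 ∷ # 615 ∷ # 74 ∷ # 952 ∷ # 851 ∷ []) ∷
  (# 522 ∷ # 109 ∷ # 828 ∷ # 966 ∷ # 991 ∷ []) ∷
  (# 241 ∷ # 568 ∷ # 1044 ∷ # 769 ∷ # 791 ∷ []) ∷
  (# 1014 ∷ # 685 ∷ # 197 ∷ # 575 ∷ # 1030 ∷ []) ∷
  (# 920 ∷ # 110 ∷ # 648 ∷ # 243 ∷ # 1039 ∷ []) ∷
  (# 967 ∷ # 1119 ∷ # 910 ∷ # 335 ∷ # 243 ∷ []) ∷
  (# 794 ∷ # 795 ∷ # 856 ∷ # 501 ∷ # 413 ∷ []) ∷
  (# 429 ∷ # 85 ∷ # 416 ∷ # 744 ∷ # 145 ∷ []) ∷
  (# 1103 ∷ # 1084 ∷ # 954 ∷ # 126 ∷ # 160 ∷ []) ∷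
  (# 924 ∷ # 798 ∷ # 531 ∷ # 667 ∷ # 771 ∷ []) ∷
  (# 992 ∷ # 447 ∷ # 150 ∷ # 170 ∷ # 302 ∷ []) ∷
  (# 493 ∷ # 465 ∷ # 850 ∷ # 258 ∷ # 31 ∷ []) ∷
  (# 310 ∷ # 537 ∷ # 864 ∷ # 164 ∷ # 704 ∷ []) ∷
  (# 984 ∷ # 480 ∷ # 944 ∷ # 972 ∷ # 299 ∷ []) ∷
  (# 913 ∷ # 793 ∷ # 198 ∷ # 1001 ∷ # 918 ∷ []) ∷
  (# 72 ∷ # 320 ∷ # 771 ∷ # 734 ∷ # 364 ∷ []) ∷
  (# 1108 ∷ # 890 ∷ # 122 ∷ # 1072 ∷ # 1064 ∷ []) ∷
  (# 210 ∷ # 993 ∷ # 808 ∷ # 587 ∷ # 309 ∷ []) ∷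
  (# 510 ∷ # 973 ∷ # 740 ∷ # 399 ∷ # 495 ∷ []) ∷
  (# 489 ∷ # 1009 ∷ # 893 ∷ # 7 ∷ # 154 ∷ []) ∷
  (# 301 ∷ # 46 ∷ # 69 ∷ # 287 ∷ # 709 ∷ []) ∷
  (# 466 ∷ # 939 ∷ # 535 ∷ # 981 ∷ # 250 ∷ []) ∷
  (# 1108 ∷ # 963 ∷ # 336 ∷ # 952 ∷ # 523 ∷ []) ∷
  (# 18 ∷ # 463 ∷ # 239 ∷ # 1020 ∷ # 265 ∷ []) ∷
  (# 271 ∷ # 136 ∷ # 447 ∷ # 531 ∷ # 493 ∷ []) ∷
  (# 971 ∷ # 104 ∷ # 137 ∷ # 757 ∷ # 863 ∷ []) ∷
  (# 864 ∷ # 78 ∷ # 839 ∷ # 175 ∷ # 526 ∷ []) ∷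
  (# 935 ∷ # 536 ∷ # 886 ∷ # 1015 ∷ # 898 ∷ []) ∷
  (# 1080 ∷ # 65 ∷ # 651 ∷ # 280 ∷ # 114 ∷ []) ∷
  (# 100 ∷ # 861 ∷ # 1110 ∷ # 613 ∷ # 810 ∷ []) ∷
  (# 953 ∷ # 113 ∷ # 500 ∷ # 344 ∷ # 686 ∷ []) ∷
  (# 1015 ∷ # 454 ∷ # 244 ∷ # 922 ∷ # 131 ∷ []) ∷
  (# 477 ∷ # 418 ∷ # 533 ∷ # 249 ∷ # 21 ∷ []) ∷
  (# 485 ∷ # 173 ∷ # 821 ∷ # 384 ∷ # 816 ∷ []) ∷
  (# 472 ∷ # 870 ∷ # 397 ∷ # 94 ∷ # 611 ∷ []) ∷
  (# 843 ∷ # 810 ∷ # 585 ∷ # 441 ∷ # 1072 ∷ []) ∷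
  (# 722 ∷ # 906 ∷ # 839 ∷ # 852 ∷ # 887 ∷ []) ∷
  (# 593 ∷ # 207 ∷ # 737 ∷ # 628 ∷ # 901 ∷ []) ∷
  (# 44 ∷ # 953 ∷ # 424 ∷ # 384 ∷ # 956 ∷ []) ∷
  (# 135 ∷ # 495 ∷ # 161 ∷ # 11 ∷ # 771 ∷ []) ∷
  (# 204 ∷ # 132 ∷ # 68 ∷ # 878 ∷ # 884 ∷ []) ∷
  (# 526 ∷ # 337 ∷ # 764 ∷ # 229 ∷ # 921 ∷ []) ∷
  (# 694 ∷ # 275 ∷ # 387 ∷ # 378 ∷ # 624 ∷ []) ∷
  (# 436 ∷ # 73 ∷ # 810 ∷ # 249 ∷ # 895 ∷ []) ∷
  (# 681 ∷ # 1013 ∷ # 999 ∷ # 165 ∷ # 394 ∷ []) ∷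
  (# 325 ∷ # 403 ∷ # 667 ∷ # 345 ∷ # 717 ∷ []) ∷
  (# 998 ∷ # 506 ∷ # 386 ∷ # 11 ∷ # 97 ∷ []) ∷
  (# 987 ∷ # 637 ∷ # 702 ∷ # 919 ∷ # 825 ∷ []) ∷
  (# 203 ∷ # 126 ∷ # 165 ∷ # 395 ∷ # 1034 ∷ []) ∷
  (# 296 ∷ # 379 ∷ # 33 ∷ # 159 ∷ # 844 ∷ []) ∷
  (# 969 ∷ # 103 ∷ # 655 ∷ # 520 ∷ # 1043 ∷ []) ∷
  (# 1022 ∷ # 336 ∷ # 656 ∷ # 913 ∷ # 464 ∷ []) ∷
  (# 956 ∷ # 657 ∷ # 339 ∷ # 87 ∷ # 589 ∷ []) ∷
  (# 285 ∷ # 1077 ∷ # 771 ∷ # 905 ∷ # 647 ∷ []) ∷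
  (# 338 ∷ # 244 ∷ # 291 ∷ # 402 ∷ # 262 ∷ []) ∷
  (# 50 ∷ # 389 ∷ # 531 ∷ # 432 ∷ # 1013 ∷ []) ∷
  (# 829 ∷ # 482 ∷ # 778 ∷ # 214 ∷ # 11 ∷ []) ∷
  (# 489 ∷ # 507 ∷ # 506 ∷ # 1073 ∷ # 706 ∷ []) ∷
  (# 1017 ∷ # 540 ∷ # 460 ∷ # 37 ∷ # 470 ∷ []) ∷
  (# 354 ∷ # 873 ∷ # 168 ∷ # 239 ∷ # 311 ∷ []) ∷
  (# 77 ∷ # 241 ∷ # 700 ∷ # 314 ∷ # 755 ∷ []) ∷
  (# 967 ∷ # 645 ∷ # 346 ∷ # 829 ∷ # 391 ∷ []) ∷
  (# 177 ∷ # 305 ∷ # 1106 ∷ # 730 ∷ # 799 ∷ []) ∷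
  (# 37 ∷ # 44 ∷ # 615 ∷ # 460 ∷ # 562 ∷ []) ∷
  (# 1041 ∷ # 695 ∷ # 614 ∷ # 773 ∷ # 162 ∷ []) ∷
  (# 407 ∷ # 514 ∷ # 235 ∷ # 612 ∷ # 733 ∷ []) ∷
  (# 335 ∷ # 688 ∷ # 244 ∷ # 398 ∷ # 856 ∷ []) ∷
  (# 1061 ∷ # 353 ∷ # 329 ∷ # 506 ∷ # 416 ∷ []) ∷
  (# 1081 ∷ # 615 ∷ # 1105 ∷ # 393 ∷ # 598 ∷ []) ∷
  (# 234 ∷ # 21 ∷ # 433 ∷ # 939 ∷ # 825 ∷ []) ∷
  (# 421 ∷ # 254 ∷ # 847 ∷ # 587 ∷ # 177 ∷ []) ∷
  (# 60 ∷ # 272 ∷ # 293 ∷ # 89 ∷ # 488 ∷ []) ∷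
  (# 961 ∷ # 295 ∷ # 489 ∷ # 29 ∷ # 814 ∷ []) ∷
  (# 201 ∷ # 231 ∷ # 775 ∷ # 233 ∷ # 290 ∷ []) ∷
  (# 385 ∷ # 1015 ∷ # 776 ∷ # 922 ∷ # 915 ∷ []) ∷
  (# 838 ∷ # 311 ∷ # 1077 ∷ # 659 ∷ # 347 ∷ []) ∷
  (# 890 ∷ # 303 ∷ # 1085 ∷ # 727 ∷ # 138 ∷ []) ∷
  (# 935 ∷ # 1103 ∷ # 134 ∷ # 914 ∷ # 1041 ∷ []) ∷
  (# 465 ∷ # 454 ∷ # 747 ∷ # 715 ∷ # 349 ∷ []) ∷
  (# 995 ∷ # 446 ∷ # 240 ∷ # 50 ∷ # 199 ∷ []) ∷
  (# 22 ∷ # 899 ∷ # 1092 ∷ # 383 ∷ # 242 ∷ []) ∷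
  (# 653 ∷ # 460 ∷ # 456 ∷ # 631 ∷ # 926 ∷ []) ∷
  (# 947 ∷ # 440 ∷ # 953 ∷ # 721 ∷ # 197 ∷ []) ∷
  (# 325 ∷ # 698 ∷ # 668 ∷ # 366 ∷ # 229 ∷ []) ∷
  (# 538 ∷ # 540 ∷ # 635 ∷ # 314 ∷ # 619 ∷ []) ∷
  (# 531 ∷ # 38 ∷ # 765 ∷ # 346 ∷ # 90 ∷ []) ∷
  (# 451 ∷ # 202 ∷ # 796 ∷ # 707 ∷ # 187 ∷ []) ∷
  (# 1118 ∷ # 754 ∷ # 1028 ∷ # 1110 ∷ # 370 ∷ []) ∷
  (# 121 ∷ # 980 ∷ # 148 ∷ # 223 ∷ # 889 ∷ []) ∷
  (# 551 ∷ # 260 ∷ # 751 ∷ # 590 ∷ # 825 ∷ []) ∷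
  (# 11 ∷ # 855 ∷ # 886 ∷ # 962 ∷ # 707 ∷ []) ∷
  (# 785 ∷ # 1066 ∷ # 663 ∷ # 65 ∷ # 348 ∷ []) ∷ []

baseBlocks1132 : List (Vec (Fin 1132) 5)
baseBlocks1132 =
  (# 736 ∷ # 0 ∷ # 276 ∷ # 32 ∷ # 824 ∷ []) ∷
  (# 497 ∷ # 1078 ∷ # 160 ∷ # 149 ∷ # 445 ∷ []) ∷
  (# 456 ∷ # 166 ∷ # 724 ∷ # 653 ∷ # 917 ∷ []) ∷
  (# 790 ∷ # 454 ∷ # 248 ∷ # 613 ∷ # 53 ∷ []) ∷
  (# 1014 ∷ # 107 ∷ # 573 ∷ # 399 ∷ # 928 ∷ []) ∷
  (# 160 ∷ # 279 ∷ # 817 ∷ # 723 ∷ # 124 ∷ []) ∷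
  (# 967 ∷ # 463 ∷ # 25 ∷ # 859 ∷ # 80 ∷ []) ∷
  (# 777 ∷ # 593 ∷ # 649 ∷ # 402 ∷ # 992 ∷ []) ∷
  (# 269 ∷ # 1049 ∷ # 793 ∷ # 22 ∷ # 640 ∷ []) ∷
  (# 647 ∷ # 905 ∷ # 1105 ∷ # 142 ∷ # 632 ∷ []) ∷
  (# 922 ∷ # 410 ∷ # 566 ∷ # 956 ∷ # 191 ∷ []) ∷
  (# 401 ∷ # 794 ∷ # 566 ∷ # 1128 ∷ # 1027 ∷ []) ∷
  (# 67 ∷ # 494 ∷ # 566 ∷ # 180 ∷ # 763 ∷ []) ∷
  (# 1078 ∷ # 646 ∷ # 447 ∷ # 258 ∷ # 419 ∷ []) ∷
  (# 889 ∷ # 362 ∷ # 827 ∷ # 842 ∷ # 955 ∷ []) ∷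
  (# 1074 ∷ # 690 ∷ # 707 ∷ # 598 ∷ # 607 ∷ []) ∷
  (# 619 ∷ # 84 ∷ # 461 ∷ # 457 ∷ # 766 ∷ []) ∷
  (# 8 ∷ # 748 ∷ # 197 ∷ # 377 ∷ # 622 ∷ []) ∷
  (# 209 ∷ # 300 ∷ # 757 ∷ # 581 ∷ # 310 ∷ []) ∷
  (# 1085 ∷ # 162 ∷ # 1131 ∷ # 484 ∷ # 779 ∷ []) ∷
  (# 62 ∷ # 634 ∷ # 611 ∷ # 860 ∷ # 603 ∷ []) ∷
  (# 750 ∷ # 902 ∷ # 239 ∷ # 920 ∷ # 599 ∷ []) ∷
  (# 507 ∷ # 358 ∷ # 42 ∷ # 447 ∷ # 504 ∷ []) ∷
  (# 1108 ∷ # 870 ∷ # 374 ∷ # 827 ∷ # 1092 ∷ []) ∷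
  (# 792 ∷ # 470 ∷ # 150 ∷ # 707 ∷ # 668 ∷ []) ∷
  (# 780 ∷ # 283 ∷ # 434 ∷ # 557 ∷ # 607 ∷ []) ∷
  (# 443 ∷ # 283 ∷ # 846 ∷ # 405 ∷ # 419 ∷ []) ∷
  (# 553 ∷ # 283 ∷ # 418 ∷ # 453 ∷ # 955 ∷ []) ∷
  (# 59 ∷ # 69 ∷ # 1097 ∷ # 388 ∷ # 613 ∷ []) ∷
  (# 363 ∷ # 857 ∷ # 1009 ∷ # 652 ∷ # 149 ∷ []) ∷
  (# 454 ∷ # 489 ∷ # 441 ∷ # 92 ∷ # 653 ∷ []) ∷
  (# 603 ∷ # 825 ∷ # 487 ∷ # 563 ∷ # 245 ∷ []) ∷
  (# 1015 ∷ # 797 ∷ # 159 ∷ # 135 ∷ # 861 ∷ []) ∷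
  (# 423 ∷ # 925 ∷ # 203 ∷ # 151 ∷ # 309 ∷ []) ∷
  (# 1090 ∷ # 1049 ∷ # 980 ∷ # 1127 ∷ # 1129 ∷ []) ∷
  (# 472 ∷ # 905 ∷ # 48 ∷ # 791 ∷ # 701 ∷ []) ∷
  (# 785 ∷ # 593 ∷ # 104 ∷ # 63 ∷ # 717 ∷ []) ∷
  (# 565 ∷ # 399 ∷ # 722 ∷ # 12 ∷ # 433 ∷ []) ∷
  (# 670 ∷ # 723 ∷ # 338 ∷ # 592 ∷ # 325 ∷ []) ∷
  (# 44 ∷ # 859 ∷ # 638 ∷ # 528 ∷ # 657 ∷ []) ∷
  (# 852 ∷ # 919 ∷ # 1101 ∷ # 157 ∷ # 926 ∷ []) ∷
  (# 802 ∷ # 1095 ∷ # 829 ∷ # 293 ∷ # 214 ∷ []) ∷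
  (# 380 ∷ # 1099 ∷ # 617 ∷ # 965 ∷ # 558 ∷ []) ∷
  (# 1113 ∷ # 618 ∷ # 268 ∷ # 290 ∷ # 909 ∷ []) ∷
  (# 646 ∷ # 490 ∷ # 392 ∷ # 534 ∷ # 413 ∷ []) ∷
  (# 567 ∷ # 590 ∷ # 472 ∷ # 874 ∷ # 93 ∷ []) ∷
  (# 258 ∷ # 287 ∷ # 1126 ∷ # 333 ∷ # 240 ∷ []) ∷
  (# 529 ∷ # 103 ∷ # 270 ∷ # 297 ∷ # 520 ∷ []) ∷
  (# 827 ∷ # 459 ∷ # 302 ∷ # 785 ∷ # 372 ∷ []) ∷
  (# 388 ∷ # 689 ∷ # 142 ∷ # 822 ∷ # 754 ∷ []) ∷
  (# 934 ∷ # 125 ∷ # 402 ∷ # 366 ∷ # 30 ∷ []) ∷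
  (# 843 ∷ # 601 ∷ # 22 ∷ # 510 ∷ # 914 ∷ []) ∷
  (# 62 ∷ # 627 ∷ # 182 ∷ # 968 ∷ # 482 ∷ []) ∷
  (# 416 ∷ # 651 ∷ # 866 ∷ # 588 ∷ # 950 ∷ []) ∷
  (# 452 ∷ # 703 ∷ # 650 ∷ # 708 ∷ # 266 ∷ []) ∷
  (# 706 ∷ # 185 ∷ # 184 ∷ # 259 ∷ # 785 ∷ []) ∷
  (# 983 ∷ # 165 ∷ # 776 ∷ # 231 ∷ # 333 ∷ []) ∷
  (# 102 ∷ # 1065 ∷ # 172 ∷ # 359 ∷ # 297 ∷ []) ∷
  (# 168 ∷ # 550 ∷ # 343 ∷ # 556 ∷ # 75 ∷ []) ∷
  (# 848 ∷ # 154 ∷ # 979 ∷ # 1016 ∷ # 587 ∷ []) ∷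
  (# 354 ∷ # 994 ∷ # 659 ∷ # 692 ∷ # 187 ∷ []) ∷
  (# 718 ∷ # 985 ∷ # 699 ∷ # 795 ∷ # 934 ∷ []) ∷
  (# 750 ∷ # 389 ∷ # 807 ∷ # 1015 ∷ # 986 ∷ []) ∷
  (# 767 ∷ # 41 ∷ # 475 ∷ # 171 ∷ # 910 ∷ []) ∷
  (# 1129 ∷ # 238 ∷ # 990 ∷ # 78 ∷ # 490 ∷ []) ∷
  (# 148 ∷ # 610 ∷ # 730 ∷ # 1018 ∷ # 590 ∷ []) ∷
  (# 1041 ∷ # 850 ∷ # 1110 ∷ # 602 ∷ # 618 ∷ []) ∷
  (# 703 ∷ # 810 ∷ # 1053 ∷ # 37 ∷ # 352 ∷ []) ∷
  (# 335 ∷ # 906 ∷ # 725 ∷ # 33 ∷ # 8 ∷ []) ∷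
  (# 1066 ∷ # 1114 ∷ # 769 ∷ # 213 ∷ # 772 ∷ []) ∷
  (# 805 ∷ # 441 ∷ # 1096 ∷ # 276 ∷ # 188 ∷ []) ∷
  (# 700 ∷ # 1097 ∷ # 488 ∷ # 32 ∷ # 596 ∷ []) ∷
  (# 326 ∷ # 1009 ∷ # 680 ∷ # 824 ∷ # 348 ∷ []) ∷
  (# 60 ∷ # 241 ∷ # 528 ∷ # 64 ∷ # 588 ∷ []) ∷
  (# 961 ∷ # 1041 ∷ # 12 ∷ # 516 ∷ # 708 ∷ []) ∷
  (# 12 ∷ # 133 ∷ # 592 ∷ # 552 ∷ # 968 ∷ []) ∷
  (# 631 ∷ # 861 ∷ # 764 ∷ # 973 ∷ # 891 ∷ []) ∷
  (# 823 ∷ # 309 ∷ # 712 ∷ # 929 ∷ # 91 ∷ []) ∷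
  (# 659 ∷ # 245 ∷ # 788 ∷ # 645 ∷ # 999 ∷ []) ∷
  (# 345 ∷ # 994 ∷ # 429 ∷ # 1006 ∷ # 823 ∷ []) ∷
  (# 713 ∷ # 550 ∷ # 505 ∷ # 10 ∷ # 887 ∷ []) ∷
  (# 212 ∷ # 154 ∷ # 481 ∷ # 682 ∷ # 271 ∷ []) ∷
  (# 25 ∷ # 205 ∷ # 732 ∷ # 839 ∷ # 993 ∷ []) ∷
  (# 776 ∷ # 397 ∷ # 1020 ∷ # 167 ∷ # 29 ∷ []) ∷
  (# 691 ∷ # 813 ∷ # 512 ∷ # 975 ∷ # 393 ∷ []) ∷
  (# 1122 ∷ # 546 ∷ # 1124 ∷ # 678 ∷ # 53 ∷ []) ∷
  (# 475 ∷ # 334 ∷ # 360 ∷ # 54 ∷ # 445 ∷ []) ∷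
  (# 311 ∷ # 818 ∷ # 780 ∷ # 966 ∷ # 917 ∷ []) ∷
  (# 74 ∷ # 1024 ∷ # 360 ∷ # 1097 ∷ # 982 ∷ []) ∷
  (# 111 ∷ # 332 ∷ # 780 ∷ # 1009 ∷ # 1090 ∷ []) ∷
  (# 369 ∷ # 908 ∷ # 1124 ∷ # 441 ∷ # 758 ∷ []) ∷
  (# 712 ∷ # 408 ∷ # 212 ∷ # 1086 ∷ # 126 ∷ []) ∷
  (# 744 ∷ # 884 ∷ # 648 ∷ # 938 ∷ # 1122 ∷ []) ∷
  (# 399 ∷ # 972 ∷ # 272 ∷ # 806 ∷ # 450 ∷ []) ∷ []

baseBlocks1144 : List (Vec (Fin 1144) 5)
baseBlocks1144 =
  (# 275 ∷ # 793 ∷ # 190 ∷ # 646 ∷ # 626 ∷ []) ∷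
  (# 628 ∷ # 478 ∷ # 671 ∷ # 784 ∷ # 24 ∷ []) ∷
  (# 522 ∷ # 297 ∷ # 741 ∷ # 121 ∷ # 146 ∷ []) ∷
  (# 872 ∷ # 395 ∷ # 321 ∷ # 367 ∷ # 111 ∷ []) ∷
  (# 338 ∷ # 482 ∷ # 251 ∷ # 12 ∷ # 1118 ∷ []) ∷
  (# 920 ∷ # 720 ∷ # 61 ∷ # 647 ∷ # 153 ∷ []) ∷
  (# 575 ∷ # 21 ∷ # 225 ∷ # 8 ∷ # 857 ∷ []) ∷
  (# 944 ∷ # 1114 ∷ # 546 ∷ # 1063 ∷ # 195 ∷ []) ∷
  (# 429 ∷ # 448 ∷ # 619 ∷ # 178 ∷ # 534 ∷ []) ∷
  (# 192 ∷ # 187 ∷ # 903 ∷ # 484 ∷ # 330 ∷ []) ∷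
  (# 794 ∷ # 13 ∷ # 1087 ∷ # 1024 ∷ # 373 ∷ []) ∷
  (# 961 ∷ # 65 ∷ # 897 ∷ # 994 ∷ # 741 ∷ []) ∷
  (# 798 ∷ # 77 ∷ # 977 ∷ # 1119 ∷ # 989 ∷ []) ∷
  (# 883 ∷ # 991 ∷ # 995 ∷ # 626 ∷ # 223 ∷ []) ∷
  (# 522 ∷ # 908 ∷ # 700 ∷ # 1074 ∷ # 1092 ∷ []) ∷
  (# 1058 ∷ # 366 ∷ # 66 ∷ # 568 ∷ # 545 ∷ []) ∷
  (# 105 ∷ # 518 ∷ # 686 ∷ # 1053 ∷ # 199 ∷ []) ∷
  (# 468 ∷ # 293 ∷ # 977 ∷ # 802 ∷ # 276 ∷ []) ∷
  (# 1016 ∷ # 367 ∷ # 570 ∷ # 513 ∷ # 678 ∷ []) ∷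
  (# 650 ∷ # 900 ∷ # 504 ∷ # 288 ∷ # 695 ∷ []) ∷
  (# 906 ∷ # 781 ∷ # 346 ∷ # 463 ∷ # 305 ∷ []) ∷
  (# 45 ∷ # 708 ∷ # 553 ∷ # 520 ∷ # 551 ∷ []) ∷
  (# 52 ∷ # 183 ∷ # 650 ∷ # 728 ∷ # 289 ∷ []) ∷
  (# 532 ∷ # 110 ∷ # 1056 ∷ # 850 ∷ # 242 ∷ []) ∷
  (# 270 ∷ # 274 ∷ # 902 ∷ # 740 ∷ # 511 ∷ []) ∷
  (# 1057 ∷ # 973 ∷ # 207 ∷ # 454 ∷ # 1091 ∷ []) ∷
  (# 481 ∷ # 628 ∷ # 339 ∷ # 378 ∷ # 896 ∷ []) ∷
  (# 727 ∷ # 1006 ∷ # 108 ∷ # 40 ∷ # 886 ∷ []) ∷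
  (# 335 ∷ # 120 ∷ # 8 ∷ # 490 ∷ # 807 ∷ []) ∷
  (# 1080 ∷ # 220 ∷ # 342 ∷ # 566 ∷ # 633 ∷ []) ∷
  (# 1090 ∷ # 119 ∷ # 698 ∷ # 397 ∷ # 868 ∷ []) ∷
  (# 196 ∷ # 511 ∷ # 734 ∷ # 1001 ∷ # 1105 ∷ []) ∷
  (# 1015 ∷ # 388 ∷ # 483 ∷ # 891 ∷ # 133 ∷ []) ∷
  (# 765 ∷ # 15 ∷ # 58 ∷ # 174 ∷ # 579 ∷ []) ∷
  (# 900 ∷ # 764 ∷ # 166 ∷ # 510 ∷ # 275 ∷ []) ∷
  (# 15 ∷ # 358 ∷ # 622 ∷ # 805 ∷ # 107 ∷ []) ∷
  (# 621 ∷ # 298 ∷ # 1080 ∷ # 838 ∷ # 385 ∷ []) ∷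
  (# 1122 ∷ # 946 ∷ # 856 ∷ # 47 ∷ # 867 ∷ []) ∷
  (# 439 ∷ # 725 ∷ # 392 ∷ # 55 ∷ # 215 ∷ []) ∷
  (# 593 ∷ # 186 ∷ # 1123 ∷ # 697 ∷ # 359 ∷ []) ∷
  (# 44 ∷ # 404 ∷ # 212 ∷ # 565 ∷ # 887 ∷ []) ∷
  (# 420 ∷ # 630 ∷ # 585 ∷ # 527 ∷ # 1081 ∷ []) ∷
  (# 1139 ∷ # 260 ∷ # 1063 ∷ # 670 ∷ # 3 ∷ []) ∷
  (# 803 ∷ # 359 ∷ # 804 ∷ # 329 ∷ # 33 ∷ []) ∷
  (# 303 ∷ # 137 ∷ # 534 ∷ # 286 ∷ # 409 ∷ []) ∷
  (# 713 ∷ # 147 ∷ # 368 ∷ # 672 ∷ # 1094 ∷ []) ∷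
  (# 247 ∷ # 301 ∷ # 172 ∷ # 650 ∷ # 514 ∷ []) ∷
  (# 681 ∷ # 1017 ∷ # 435 ∷ # 411 ∷ # 95 ∷ []) ∷
  (# 696 ∷ # 299 ∷ # 85 ∷ # 99 ∷ # 348 ∷ []) ∷
  (# 413 ∷ # 597 ∷ # 155 ∷ # 136 ∷ # 170 ∷ []) ∷
  (# 193 ∷ # 77 ∷ # 1138 ∷ # 158 ∷ # 286 ∷ []) ∷
  (# 825 ∷ # 968 ∷ # 685 ∷ # 1079 ∷ # 505 ∷ []) ∷
  (# 26 ∷ # 641 ∷ # 926 ∷ # 527 ∷ # 599 ∷ []) ∷
  (# 581 ∷ # 360 ∷ # 1000 ∷ # 486 ∷ # 861 ∷ []) ∷
  (# 976 ∷ # 286 ∷ # 1137 ∷ # 1006 ∷ # 221 ∷ []) ∷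
  (# 370 ∷ # 198 ∷ # 176 ∷ # 303 ∷ # 410 ∷ []) ∷
  (# 919 ∷ # 154 ∷ # 934 ∷ # 204 ∷ # 898 ∷ []) ∷
  (# 70 ∷ # 736 ∷ # 743 ∷ # 1075 ∷ # 252 ∷ []) ∷
  (# 983 ∷ # 664 ∷ # 134 ∷ # 543 ∷ # 598 ∷ []) ∷
  (# 95 ∷ # 867 ∷ # 857 ∷ # 704 ∷ # 1052 ∷ []) ∷
  (# 827 ∷ # 762 ∷ # 449 ∷ # 701 ∷ # 475 ∷ []) ∷
  (# 715 ∷ # 403 ∷ # 804 ∷ # 788 ∷ # 728 ∷ []) ∷
  (# 960 ∷ # 278 ∷ # 366 ∷ # 130 ∷ # 922 ∷ []) ∷
  (# 751 ∷ # 398 ∷ # 342 ∷ # 35 ∷ # 452 ∷ []) ∷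
  (# 1123 ∷ # 443 ∷ # 23 ∷ # 381 ∷ # 712 ∷ []) ∷
  (# 767 ∷ # 368 ∷ # 970 ∷ # 965 ∷ # 1089 ∷ []) ∷
  (# 177 ∷ # 1019 ∷ # 180 ∷ # 829 ∷ # 776 ∷ []) ∷
  (# 898 ∷ # 908 ∷ # 856 ∷ # 955 ∷ # 626 ∷ []) ∷
  (# 599 ∷ # 1059 ∷ # 126 ∷ # 446 ∷ # 454 ∷ []) ∷
  (# 307 ∷ # 239 ∷ # 276 ∷ # 428 ∷ # 687 ∷ []) ∷
  (# 483 ∷ # 998 ∷ # 397 ∷ # 306 ∷ # 779 ∷ []) ∷
  (# 1069 ∷ # 48 ∷ # 575 ∷ # 1128 ∷ # 991 ∷ []) ∷
  (# 1138 ∷ # 1066 ∷ # 805 ∷ # 1114 ∷ # 236 ∷ []) ∷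
  (# 922 ∷ # 274 ∷ # 695 ∷ # 88 ∷ # 1082 ∷ []) ∷
  (# 256 ∷ # 158 ∷ # 591 ∷ # 945 ∷ # 687 ∷ []) ∷
  (# 961 ∷ # 85 ∷ # 303 ∷ # 565 ∷ # 1057 ∷ []) ∷
  (# 694 ∷ # 946 ∷ # 125 ∷ # 631 ∷ # 658 ∷ []) ∷
  (# 631 ∷ # 207 ∷ # 1131 ∷ # 996 ∷ # 693 ∷ []) ∷
  (# 806 ∷ # 188 ∷ # 617 ∷ # 732 ∷ # 270 ∷ []) ∷
  (# 1104 ∷ # 236 ∷ # 380 ∷ # 795 ∷ # 940 ∷ []) ∷
  (# 978 ∷ # 137 ∷ # 48 ∷ # 57 ∷ # 609 ∷ []) ∷
  (# 1006 ∷ # 390 ∷ # 484 ∷ # 209 ∷ # 483 ∷ []) ∷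
  (# 148 ∷ # 419 ∷ # 21 ∷ # 652 ∷ # 1064 ∷ []) ∷
  (# 245 ∷ # 1064 ∷ # 784 ∷ # 326 ∷ # 824 ∷ []) ∷
  (# 165 ∷ # 362 ∷ # 664 ∷ # 287 ∷ # 943 ∷ []) ∷
  (# 1105 ∷ # 406 ∷ # 265 ∷ # 831 ∷ # 644 ∷ []) ∷
  (# 184 ∷ # 513 ∷ # 896 ∷ # 902 ∷ # 286 ∷ []) ∷
  (# 550 ∷ # 450 ∷ # 421 ∷ # 19 ∷ # 731 ∷ []) ∷
  (# 1054 ∷ # 686 ∷ # 47 ∷ # 318 ∷ # 512 ∷ []) ∷
  (# 1037 ∷ # 475 ∷ # 94 ∷ # 234 ∷ # 293 ∷ []) ∷
  (# 973 ∷ # 488 ∷ # 1010 ∷ # 876 ∷ # 417 ∷ []) ∷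
  (# 253 ∷ # 367 ∷ # 332 ∷ # 335 ∷ # 956 ∷ []) ∷
  (# 974 ∷ # 357 ∷ # 691 ∷ # 257 ∷ # 426 ∷ []) ∷
  (# 1070 ∷ # 838 ∷ # 882 ∷ # 37 ∷ # 175 ∷ []) ∷
  (# 1122 ∷ # 488 ∷ # 782 ∷ # 684 ∷ # 761 ∷ []) ∷ []

baseBlocks1156 : List (Vec (Fin 1156) 5)
baseBlocks1156 =
  (# 406 ∷ # 137 ∷ # 1020 ∷ # 404 ∷ # 726 ∷ []) ∷
  (# 129 ∷ # 22 ∷ # 522 ∷ # 62 ∷ # 737 ∷ []) ∷
  (# 522 ∷ # 1108 ∷ # 573 ∷ # 390 ∷ # 769 ∷ []) ∷
  (# 241 ∷ # 473 ∷ # 465 ∷ # 796 ∷ # 805 ∷ []) ∷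
  (# 1014 ∷ # 713 ∷ # 16 ∷ # 368 ∷ # 1114 ∷ []) ∷
  (# 920 ∷ # 1138 ∷ # 518 ∷ # 917 ∷ # 581 ∷ []) ∷
  (# 1011 ∷ # 92 ∷ # 8 ∷ # 1067 ∷ # 57 ∷ []) ∷
  (# 877 ∷ # 351 ∷ # 772 ∷ # 482 ∷ # 410 ∷ []) ∷
  (# 468 ∷ # 183 ∷ # 639 ∷ # 544 ∷ # 441 ∷ []) ∷
  (# 682 ∷ # 614 ∷ # 265 ∷ # 1080 ∷ # 6 ∷ []) ∷
  (# 213 ∷ # 153 ∷ # 1083 ∷ # 640 ∷ # 863 ∷ []) ∷
  (# 450 ∷ # 323 ∷ # 304 ∷ # 841 ∷ # 216 ∷ []) ∷
  (# 798 ∷ # 84 ∷ # 1065 ∷ # 1127 ∷ # 814 ∷ []) ∷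
  (# 196 ∷ # 511 ∷ # 154 ∷ # 42 ∷ # 942 ∷ []) ∷
  (# 749 ∷ # 401 ∷ # 1146 ∷ # 734 ∷ # 702 ∷ []) ∷
  (# 569 ∷ # 1033 ∷ # 891 ∷ # 892 ∷ # 822 ∷ []) ∷
  (# 328 ∷ # 675 ∷ # 812 ∷ # 31 ∷ # 501 ∷ []) ∷
  (# 735 ∷ # 838 ∷ # 807 ∷ # 992 ∷ # 424 ∷ []) ∷
  (# 209 ∷ # 696 ∷ # 67 ∷ # 492 ∷ # 863 ∷ []) ∷
  (# 953 ∷ # 1146 ∷ # 408 ∷ # 230 ∷ # 174 ∷ []) ∷
  (# 26 ∷ # 431 ∷ # 921 ∷ # 350 ∷ # 427 ∷ []) ∷
  (# 45 ∷ # 876 ∷ # 982 ∷ # 68 ∷ # 922 ∷ []) ∷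
  (# 52 ∷ # 673 ∷ # 258 ∷ # 905 ∷ # 834 ∷ []) ∷
  (# 1062 ∷ # 632 ∷ # 5 ∷ # 110 ∷ # 382 ∷ []) ∷
  (# 650 ∷ # 94 ∷ # 1140 ∷ # 498 ∷ # 177 ∷ []) ∷
  (# 242 ∷ # 751 ∷ # 731 ∷ # 299 ∷ # 328 ∷ []) ∷
  (# 443 ∷ # 1084 ∷ # 940 ∷ # 255 ∷ # 333 ∷ []) ∷
  (# 399 ∷ # 703 ∷ # 642 ∷ # 942 ∷ # 48 ∷ []) ∷
  (# 59 ∷ # 741 ∷ # 553 ∷ # 953 ∷ # 551 ∷ []) ∷
  (# 168 ∷ # 162 ∷ # 247 ∷ # 974 ∷ # 47 ∷ []) ∷
  (# 284 ∷ # 1059 ∷ # 899 ∷ # 1152 ∷ # 173 ∷ []) ∷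
  (# 896 ∷ # 461 ∷ # 883 ∷ # 4 ∷ # 830 ∷ []) ∷
  (# 531 ∷ # 1019 ∷ # 499 ∷ # 754 ∷ # 700 ∷ []) ∷
  (# 67 ∷ # 695 ∷ # 498 ∷ # 126 ∷ # 411 ∷ []) ∷
  (# 477 ∷ # 856 ∷ # 107 ∷ # 175 ∷ # 568 ∷ []) ∷
  (# 707 ∷ # 567 ∷ # 415 ∷ # 372 ∷ # 542 ∷ []) ∷
  (# 472 ∷ # 884 ∷ # 1043 ∷ # 251 ∷ # 104 ∷ []) ∷
  (# 938 ∷ # 27 ∷ # 55 ∷ # 1117 ∷ # 522 ∷ []) ∷
  (# 941 ∷ # 391 ∷ # 456 ∷ # 665 ∷ # 643 ∷ []) ∷
  (# 593 ∷ # 588 ∷ # 1004 ∷ # 887 ∷ # 801 ∷ []) ∷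
  (# 405 ∷ # 78 ∷ # 655 ∷ # 781 ∷ # 42 ∷ []) ∷
  (# 852 ∷ # 661 ∷ # 510 ∷ # 830 ∷ # 658 ∷ []) ∷
  (# 992 ∷ # 459 ∷ # 69 ∷ # 737 ∷ # 283 ∷ []) ∷
  (# 204 ∷ # 238 ∷ # 838 ∷ # 347 ∷ # 56 ∷ []) ∷
  (# 380 ∷ # 519 ∷ # 984 ∷ # 687 ∷ # 845 ∷ []) ∷
  (# 445 ∷ # 565 ∷ # 612 ∷ # 920 ∷ # 1084 ∷ []) ∷
  (# 344 ∷ # 942 ∷ # 947 ∷ # 960 ∷ # 797 ∷ []) ∷
  (# 76 ∷ # 146 ∷ # 810 ∷ # 250 ∷ # 220 ∷ []) ∷
  (# 804 ∷ # 37 ∷ # 912 ∷ # 682 ∷ # 255 ∷ []) ∷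
  (# 864 ∷ # 569 ∷ # 527 ∷ # 211 ∷ # 1113 ∷ []) ∷
  (# 305 ∷ # 241 ∷ # 343 ∷ # 816 ∷ # 592 ∷ []) ∷
  (# 965 ∷ # 900 ∷ # 778 ∷ # 503 ∷ # 237 ∷ []) ∷
  (# 621 ∷ # 527 ∷ # 435 ∷ # 670 ∷ # 660 ∷ []) ∷
  (# 890 ∷ # 679 ∷ # 490 ∷ # 197 ∷ # 354 ∷ []) ∷
  (# 85 ∷ # 964 ∷ # 104 ∷ # 745 ∷ # 868 ∷ []) ∷
  (# 842 ∷ # 335 ∷ # 32 ∷ # 672 ∷ # 797 ∷ []) ∷
  (# 683 ∷ # 101 ∷ # 548 ∷ # 50 ∷ # 413 ∷ []) ∷
  (# 298 ∷ # 628 ∷ # 1008 ∷ # 1136 ∷ # 44 ∷ []) ∷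
  (# 744 ∷ # 964 ∷ # 399 ∷ # 1002 ∷ # 500 ∷ []) ∷
  (# 951 ∷ # 388 ∷ # 992 ∷ # 382 ∷ # 1110 ∷ []) ∷
  (# 1145 ∷ # 1108 ∷ # 689 ∷ # 402 ∷ # 43 ∷ []) ∷
  (# 848 ∷ # 253 ∷ # 391 ∷ # 582 ∷ # 212 ∷ []) ∷
  (# 354 ∷ # 259 ∷ # 832 ∷ # 1042 ∷ # 1065 ∷ []) ∷
  (# 194 ∷ # 685 ∷ # 1143 ∷ # 1109 ∷ # 1019 ∷ []) ∷
  (# 779 ∷ # 249 ∷ # 755 ∷ # 1038 ∷ # 44 ∷ []) ∷
  (# 594 ∷ # 504 ∷ # 531 ∷ # 18 ∷ # 1153 ∷ []) ∷
  (# 177 ∷ # 61 ∷ # 141 ∷ # 1141 ∷ # 913 ∷ []) ∷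
  (# 738 ∷ # 581 ∷ # 542 ∷ # 557 ∷ # 990 ∷ []) ∷
  (# 1041 ∷ # 133 ∷ # 900 ∷ # 247 ∷ # 582 ∷ []) ∷
  (# 388 ∷ # 171 ∷ # 984 ∷ # 1017 ∷ # 378 ∷ []) ∷
  (# 335 ∷ # 378 ∷ # 390 ∷ # 929 ∷ # 874 ∷ []) ∷
  (# 1066 ∷ # 238 ∷ # 476 ∷ # 1087 ∷ # 830 ∷ []) ∷
  (# 1131 ∷ # 691 ∷ # 1005 ∷ # 475 ∷ # 677 ∷ []) ∷
  (# 514 ∷ # 45 ∷ # 443 ∷ # 1 ∷ # 680 ∷ []) ∷
  (# 537 ∷ # 1125 ∷ # 134 ∷ # 903 ∷ # 232 ∷ []) ∷
  (# 60 ∷ # 1098 ∷ # 635 ∷ # 692 ∷ # 61 ∷ []) ∷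
  (# 961 ∷ # 115 ∷ # 583 ∷ # 1141 ∷ # 662 ∷ []) ∷
  (# 936 ∷ # 151 ∷ # 969 ∷ # 199 ∷ # 587 ∷ []) ∷
  (# 1138 ∷ # 78 ∷ # 606 ∷ # 561 ∷ # 314 ∷ []) ∷
  (# 873 ∷ # 70 ∷ # 1018 ∷ # 301 ∷ # 775 ∷ []) ∷
  (# 370 ∷ # 552 ∷ # 186 ∷ # 989 ∷ # 1078 ∷ []) ∷
  (# 1050 ∷ # 373 ∷ # 366 ∷ # 125 ∷ # 200 ∷ []) ∷
  (# 953 ∷ # 236 ∷ # 1121 ∷ # 740 ∷ # 81 ∷ []) ∷
  (# 464 ∷ # 9 ∷ # 315 ∷ # 109 ∷ # 870 ∷ []) ∷
  (# 1036 ∷ # 65 ∷ # 173 ∷ # 199 ∷ # 935 ∷ []) ∷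
  (# 403 ∷ # 922 ∷ # 112 ∷ # 654 ∷ # 617 ∷ []) ∷
  (# 161 ∷ # 576 ∷ # 984 ∷ # 705 ∷ # 885 ∷ []) ∷
  (# 260 ∷ # 656 ∷ # 1136 ∷ # 32 ∷ # 278 ∷ []) ∷
  (# 158 ∷ # 1116 ∷ # 275 ∷ # 81 ∷ # 976 ∷ []) ∷
  (# 108 ∷ # 975 ∷ # 101 ∷ # 590 ∷ # 579 ∷ []) ∷
  (# 1052 ∷ # 685 ∷ # 735 ∷ # 668 ∷ # 536 ∷ []) ∷
  (# 877 ∷ # 150 ∷ # 674 ∷ # 394 ∷ # 77 ∷ []) ∷
  (# 28 ∷ # 1021 ∷ # 1132 ∷ # 776 ∷ # 341 ∷ []) ∷
  (# 940 ∷ # 702 ∷ # 1044 ∷ # 148 ∷ # 164 ∷ []) ∷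
  (# 145 ∷ # 410 ∷ # 850 ∷ # 581 ∷ # 257 ∷ []) ∷
  (# 757 ∷ # 61 ∷ # 870 ∷ # 684 ∷ # 1097 ∷ []) ∷ []

corollary4p17 : ∀ (v : ℕ) → v ∈ (376 ∷ 388 ∷ 544 ∷ 556 ∷ 568 ∷ 580 ∷ 880 ∷ 892 ∷ 1120 ∷ 1132 ∷ 1144 ∷ 1156 ∷ []) → NestedBIBDExists v 4 1
corollary4p17 _ = All.lookup designs
  where
  designs : All (λ v → NestedBIBDExists v 4 1) (376 ∷ 388 ∷ 544 ∷ 556 ∷ 568 ∷ 580 ∷ 880 ∷ 892 ∷ 1120 ∷ 1132 ∷ 1144 ∷ 1156 ∷ [])
  designs = SubgroupOfOrder4.nestedBIBD 94 (# 351) baseBlocks376 ∷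
          SubgroupOfOrder4.nestedBIBD 97 (# 299) baseBlocks388 ∷
          SubgroupOfOrder4.nestedBIBD 136 (# 249) baseBlocks544 ∷
          SubgroupOfOrder4.nestedBIBD 139 (# 515) baseBlocks556 ∷
          SubgroupOfOrder4.nestedBIBD 142 (# 512) baseBlocks568 ∷
          SubgroupOfOrder4.nestedBIBD 145 (# 555) baseBlocks580 ∷
          SubgroupOfOrder4.nestedBIBD 220 (# 738) baseBlocks880 ∷
          SubgroupOfOrder4.nestedBIBD 223 (# 757) baseBlocks892 ∷
          SubgroupOfOrder4.nestedBIBD 280 (# 1049) baseBlocks1120 ∷
          SubgroupOfOrder4.nestedBIBD 283 (# 793) baseBlocks1132 ∷
          SubgroupOfOrder4.nestedBIBD 286 (# 11) baseBlocks1144 ∷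
          SubgroupOfOrder4.nestedBIBD 289 (# 11) baseBlocks1156 ∷
          []
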